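{- Let $k\ge 2$ and let $C_{2k}$ be the cycle on $2k$ vertices. The poset of faces of $\mathcal{P}_{C_{2k}}$ other than $\mathcal{P}_{C_{2k}}$ itself (including the empty face), ordered by inclusion, is isomorphic to the set of all ordered pairs $(A,B)$ of disjoint subsets of $\{1,\dots,2k\}$ such that either $|A|=|B|=k$ or $|A|,|B|<k$, ordered by $(A,B)\le(A',B')$ iff $A\subseteq A'$ and $B\subseteq B'$. In particular, the number $f_i$ of $i$-dimensional faces of $\mathcal{P}_{C_{2k}}$ is $f_{2k-2}=\binom{2k}{k}$ and, for $-1\le i<2k-2$, \[f_i=\sum_{\substack{a+b=i+1\\ a<k,\ b<k}}\binom{2k}{a}\binom{2k-a}{b}.\]
   Context: For a graph $G=(V,E)$, the symmetric edge polytope is $\mathcal{P}_G:=\mathrm{conv}\{\mathbf{e}_v-\mathbf{e}_w,\ \mathbf{e}_w-\mathbf{e}_v : \{v,w\}\in E\}\subset\mathbb{R}^V$. The empty face counts as the face of dimension $-1$. -}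

module Defs where

open import Data.Nat as ℕ using (ℕ; zero; suc; _<_; _≤_; _∸_; _<?_)
open import Data.Nat.DivMod using (_%_; m%n<n)
open import Data.Nat.Combinatorics using (_C_)
open import Data.Integer as ℤ using (ℤ; 0ℤ; 1ℤ)
open import Data.Fin as Fin using (Fin; toℕ; fromℕ<)
open import Data.Fin.Subset using (Subset; _∈_; _⊆_; _∩_; Empty; ∣_∣)
open import Data.Bool using (Bool; true; false; if_then_else_; _∧_)
open import Data.Product using (Σ; _×_; _,_; proj₁)
open import Data.Sum using (_⊎_)
open import Data.List using (List; length; map; upTo)
open import Data.Nat.ListAction using (sum)
open import Data.List.Relation.Unary.Unique.Propositional using (Unique)
open import Data.List.Membership.Propositional renaming (_∈_ to _∈ₗ_)
open import Relation.Nullary using (¬_; does)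
open import Relation.Binary.PropositionalEquality using (_≡_)
open import Function.Bundles using (_⇔_)

-- The cycle C_n on vertex set Fin n: edges {i , next i}, next i = i+1 mod n.

next : ∀ {n} → Fin n → Fin n
next {suc m} i = fromℕ< (m%n<n (suc (toℕ i)) (suc m))

δ : ∀ {n} → Fin n → Fin n → ℤ
δ v w = if does (v Fin.≟ w) then 1ℤ else 0ℤ

-- The generating points of P_{C_n}: an oriented edge (i , b).
--   (i , true)  ↦ e_i − e_{next i}
--   (i , false) ↦ e_{next i} − e_i
Pt : ℕ → Set
Pt n = Fin n × Bool

point : ∀ {n} → Pt n → Fin n → ℤ
point (i , true)  v = δ v i ℤ.- δ v (next i)
point (i , false) v = δ v (next i) ℤ.- δ v i

∑ : ∀ {n} → (Fin n → ℤ) → ℤ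
∑ {zero}  f = 0ℤ
∑ {suc n} f = f Fin.zero ℤ.+ ∑ (λ i → f (Fin.suc i))

∑ₚ : ∀ {n} → (Pt n → ℤ) → ℤ
∑ₚ f = ∑ (λ i → f (i , true) ℤ.+ f (i , false))

⟨_,_⟩ : ∀ {n} → (Fin n → ℤ) → (Fin n → ℤ) → ℤ
⟨ c , x ⟩ = ∑ (λ v → c v ℤ.* x v)

-- A set of generating points: (S⁺ , S⁻) with (i , true) ∈ S iff i ∈ S⁺,
-- (i , false) ∈ S iff i ∈ S⁻.  A face of P is identified with its vertex
-- set (every generating point of a symmetric edge polytope is a vertex).

PtSet : ℕ → Set
PtSet n = Subset n × Subset n

_∈ₚ_ : ∀ {n} → Pt n → PtSet n → Set
(i , true)  ∈ₚ (S⁺ , S⁻) = i ∈ S⁺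
(i , false) ∈ₚ (S⁺ , S⁻) = i ∈ S⁻

_⊆ₚ_ : ∀ {n} → PtSet n → PtSet n → Set
(S⁺ , S⁻) ⊆ₚ (T⁺ , T⁻) = (S⁺ ⊆ T⁺) × (S⁻ ⊆ T⁻)

∣_∣ₚ : ∀ {n} → PtSet n → ℕ
∣ (S⁺ , S⁻) ∣ₚ = ∣ S⁺ ∣ ℕ.+ ∣ S⁻ ∣

-- S is the vertex set of the face of P_{C_n} maximising the linear
-- functional c (integer c suffice: P is a lattice polytope).
IsExposed : ∀ {n} → PtSet n → Set
IsExposed {n} S = Σ (Fin n → ℤ) λ c →
  ∀ x → (x ∈ₚ S) ⇔ (∀ y → ⟨ c , point y ⟩ ℤ.≤ ⟨ c , point x ⟩)

EmptyPt : ∀ {n} → PtSet n → Set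
EmptyPt S = ∀ x → ¬ (x ∈ₚ S)

FullPt : ∀ {n} → PtSet n → Set
FullPt S = ∀ x → x ∈ₚ S

IsFace : ∀ {n} → PtSet n → Set
IsFace S = EmptyPt S ⊎ IsExposed S

IsProperFace : ∀ {n} → PtSet n → Set
IsProperFace S = IsFace S × ¬ FullPt S

-- affine independence of the points in T (over ℚ, equivalently over ℤ)
AffIndep : ∀ {n} → PtSet n → Set
AffIndep {n} T = (μ : Pt n → ℤ) →
  (∀ x → ¬ (x ∈ₚ T) → μ x ≡ 0ℤ) →
  ∑ₚ μ ≡ 0ℤ →
  (∀ v → ∑ₚ (λ x → μ x ℤ.* point x v) ≡ 0ℤ) →
  ∀ x → μ x ≡ 0ℤ

-- dim conv(S) + 1 ≡ m  (max number of affinely independent points of S)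
DimSuc : ∀ {n} → PtSet n → ℕ → Set
DimSuc S m =
  Σ _ (λ T → T ⊆ₚ S × AffIndep T × ∣ T ∣ₚ ≡ m)
  × (∀ T → T ⊆ₚ S → AffIndep T → ∣ T ∣ₚ ≤ m)

HasCard : ∀ {n} → (PtSet n → Set) → ℕ → Set
HasCard {n} P N = Σ (List (PtSet n)) λ L →
  Unique L × length L ≡ N × (∀ S → (S ∈ₗ L) ⇔ P S)

IsGoodPair : ∀ (k : ℕ) → Subset (2 ℕ.* k) × Subset (2 ℕ.* k) → Set
IsGoodPair k (A , B) = Empty (A ∩ B) ×
  ((∣ A ∣ ≡ k × ∣ B ∣ ≡ k) ⊎ (∣ A ∣ < k × ∣ B ∣ < k))

_≤ₚ_ : ∀ {n} → Subset n × Subset n → Subset n × Subset n → Set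
(A , B) ≤ₚ (A' , B') = (A ⊆ A') × (B ⊆ B')

faceSum : ℕ → ℕ → ℕ
faceSum k j = sum (map term (upTo (suc j)))
  where
  term : ℕ → ℕ
  term a = if does (a <? k) ∧ does ((j ∸ a) <? k)
           then ((2 ℕ.* k) C a) ℕ.* (((2 ℕ.* k) ∸ a) C (j ∸ a))
           else 0

{-# OPTIONS --safe #-}

-- A linear functional c takes the value d i = c i − c (i + 1) on the point e_i − e_{i+1} and − d i on
-- its opposite, and the vectors d arising in this way are exactly those with ∑ d = 0. So a face is the
-- set of oriented edges on which ± d attains its maximum M: everything if M ≤ 0, and otherwise the pair
-- A = {d = M}, B = {d = − M}. As ∑ d = 0 and d ≥ − M, if A has at least k of the 2k edges then it has
-- exactly k and d = − M on all the others, so |A| = |B| = k; otherwise |A|, |B| < k. Conversely every such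
-- pair is cut out by a suitable d. An affine relation among the points is a circulation on the cycle,
-- so it has the same net flow on every edge: a disjoint pair missing some vertex is affinely
-- independent, while a partition with |A| = |B| carries the relation χ_A − χ_B. This gives the
-- dimensions, and the face numbers count disjoint pairs by size: C(n, a) C(n − a, b) of sizes (a, b).

module Submission where

open import Defs
open import Data.Nat using (ℕ; _≤_; _<_; _*_; _∸_)
open import Data.Nat.Combinatorics using (_C_)
open import Data.Fin.Subset using (Subset)
open import Data.Product using (Σ; _×_; proj₁)
open import Relation.Binary.PropositionalEquality using (_≡_)
open import Function.Bundles using (_⇔_)

open import Data.Bool using (Bool; true; false; if_then_else_; _∧_; T)
open import Data.Bool.Properties using (T-∧)
open import Data.Fin as Fin using (Fin; zero; suc; inject₁; fromℕ; toℕ)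
import Data.Fin.Properties as Finₚ
open import Data.Fin.Properties using (any?)
open import Data.Fin.Relation.Unary.Top using (view; ‵fromℕ; ‵inject₁)
open import Data.Fin.Subset using (_∈_; _∉_; _⊆_; _⊂_; _∩_; ∁; Empty; ∣_∣; ⊤; ⁅_⁆; outside)
open import Data.Fin.Subset.Properties
  using (_∈?_; x∈p∩q⁺; x∈p∩q⁻; x∈∁p⇒x∉p; x∉p⇒x∈∁p; ∣∁p∣≡n∸∣p∣; ∣p∣≤n; p⊆q⇒∣p∣≤∣q∣; p⊂q⇒∣p∣<∣q∣;
         ∣⊤∣≡n; ∣⁅x⁆∣≡1; x≢y⇒x∉⁅y⁆; ∣⊥∣≡0; Empty-unique; nonempty?; drop-∷-Empty)
open import Data.Integer using (ℤ; +_; -_; -[1+_]; 0ℤ; 1ℤ; +≤+; -≤+; +<+)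
  renaming (_+_ to _+ᶻ_; _-_ to _-ᶻ_; _*_ to _*ᶻ_; _≤_ to _≤ᶻ_; _<_ to _<ᶻ_)
import Data.Integer.Properties as ℤₚ
open import Data.Integer.Tactic.RingSolver using (solve-∀)
open import Data.List using (List; []; _∷_; _++_; map; length; concatMap; upTo; allFin; cartesianProduct)
import Data.List.Extrema as Extrema
open import Data.List.Membership.Propositional using (find; lose) renaming (_∈_ to _∈ₗ_)
open import Data.List.Membership.Propositional.Properties
  using (∈-allFin; ∈-cartesianProduct⁺; ∈-map⁺; ∈-map⁻; ∈-++⁺ˡ; ∈-++⁺ʳ; ∈-++⁻; ∈-concatMap⁺; ∈-concatMap⁻;
         ∈-upTo⁺; ∈-upTo⁻)
import Data.List.Properties as LP
open import Data.List.Relation.Binary.Disjoint.Propositional using (Disjoint)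
import Data.List.Relation.Unary.All as All
import Data.List.Relation.Unary.All.Properties as AllP
import Data.List.Relation.Unary.AllPairs as AllPairs
open import Data.List.Relation.Unary.AllPairs using ([]; _∷_)
import Data.List.Relation.Unary.AllPairs.Properties as AllPairsP
open import Data.List.Relation.Unary.Any using (here; there)
open import Data.List.Relation.Unary.Unique.Propositional using (Unique)
import Data.List.Relation.Unary.Unique.Propositional.Properties as Unique
open import Data.Nat as ℕ using (zero; suc; _+_; z≤n; s≤s; _<?_)
open import Data.Nat.Combinatorics using (nCk+nC[k+1]≡[n+1]C[k+1]; k>n⇒nCk≡0; nCn≡1)
open import Data.Nat.DivMod using (_%_; m<n⇒m%n≡m; n%n≡0)
open import Data.Nat.ListAction using (sum)
import Data.Nat.Properties as ℕₚ
open import Data.Product using (∃; _,_; proj₂)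
open import Data.Sum using (_⊎_; inj₁; inj₂; [_,_])
open import Data.Vec using (lookup; []; _∷_; here; there)
open import Data.Vec.Properties using ([]=⇒lookup; lookup⇒[]=)
open import Function using (_∘_; id)
open import Function.Bundles using (mk⇔; Equivalence)
import Function.Properties.Equivalence as ⇔
open import Relation.Binary.PropositionalEquality
  using (refl; sym; trans; cong; cong₂; subst; subst₂; _≢_; module ≡-Reasoning)
open import Relation.Nullary using (¬_; ¬?; Dec; does; yes; no; _×-dec_)
open import Relation.Nullary.Negation using (contradiction)

∑-cong : ∀ {n} {f g : Fin n → ℤ} → (∀ i → f i ≡ g i) → ∑ f ≡ ∑ g
∑-cong {zero}  f≗g = refl
∑-cong {suc n} f≗g = cong₂ _+ᶻ_ (f≗g zero) (∑-cong (f≗g ∘ suc))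

∑-zero : ∀ {n} {f : Fin n → ℤ} → (∀ i → f i ≡ 0ℤ) → ∑ f ≡ 0ℤ
∑-zero {zero}  f≗0 = refl
∑-zero {suc n} f≗0 = cong₂ _+ᶻ_ (f≗0 zero) (∑-zero (f≗0 ∘ suc))

∑-distrib-+ : ∀ {n} (f g : Fin n → ℤ) → ∑ (λ i → f i +ᶻ g i) ≡ ∑ f +ᶻ ∑ g
∑-distrib-+ {zero}  f g = refl
∑-distrib-+ {suc n} f g =
  trans (cong (f zero +ᶻ g zero +ᶻ_) (∑-distrib-+ (f ∘ suc) (g ∘ suc)))
        (interchange (f zero) (g zero) _ _)
  where
  interchange : ∀ a b c d → a +ᶻ b +ᶻ (c +ᶻ d) ≡ a +ᶻ c +ᶻ (b +ᶻ d)
  interchange = solve-∀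

∑-neg : ∀ {n} (f : Fin n → ℤ) → ∑ (λ i → - f i) ≡ - ∑ f
∑-neg {zero}  f = refl
∑-neg {suc n} f = trans (cong (- f zero +ᶻ_) (∑-neg (f ∘ suc)))
                        (sym (ℤₚ.neg-distrib-+ (f zero) _))

∑-distrib-- : ∀ {n} (f g : Fin n → ℤ) → ∑ (λ i → f i -ᶻ g i) ≡ ∑ f -ᶻ ∑ g
∑-distrib-- f g = trans (∑-distrib-+ f (λ i → - g i)) (cong (∑ f +ᶻ_) (∑-neg g))

∑-*ˡ : ∀ {n} (c : ℤ) (f : Fin n → ℤ) → ∑ (λ i → c *ᶻ f i) ≡ c *ᶻ ∑ f
∑-*ˡ {zero}  c f = sym (ℤₚ.*-zeroʳ c)
∑-*ˡ {suc n} c f = trans (cong (c *ᶻ f zero +ᶻ_) (∑-*ˡ c (f ∘ suc)))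
                         (sym (ℤₚ.*-distribˡ-+ c (f zero) _))

∑-const-1 : ∀ n → ∑ {n} (λ _ → 1ℤ) ≡ + n
∑-const-1 zero    = refl
∑-const-1 (suc n) = cong (1ℤ +ᶻ_) (∑-const-1 n)

∑-single : ∀ {n} (f : Fin n → ℤ) (j : Fin n) → (∀ i → i ≢ j → f i ≡ 0ℤ) → ∑ f ≡ f j
∑-single f zero f≗0 =
  trans (cong (f zero +ᶻ_) (∑-zero (λ i → f≗0 (suc i) (Finₚ.0≢1+n ∘ sym)))) (ℤₚ.+-identityʳ _)
∑-single f (suc j) f≗0 =
  trans (cong₂ _+ᶻ_ (f≗0 zero Finₚ.0≢1+n) (∑-single (f ∘ suc) j λ i i≢j → f≗0 (suc i) (i≢j ∘ Finₚ.suc-injective)))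
        (ℤₚ.+-identityˡ _)

∑-init-last : ∀ {m} (f : Fin (suc m) → ℤ) → ∑ f ≡ ∑ (f ∘ inject₁) +ᶻ f (fromℕ m)
∑-init-last {zero}  f = ℤₚ.+-comm (f zero) 0ℤ
∑-init-last {suc m} f = trans (cong (f zero +ᶻ_) (∑-init-last (f ∘ suc)))
                              (sym (ℤₚ.+-assoc (f zero) _ _))

∑-nonneg : ∀ {n} {f : Fin n → ℤ} → (∀ i → 0ℤ ≤ᶻ f i) → 0ℤ ≤ᶻ ∑ f
∑-nonneg {zero}  0≤f = ℤₚ.≤-refl
∑-nonneg {suc n} 0≤f = ℤₚ.+-mono-≤ (0≤f zero) (∑-nonneg (0≤f ∘ suc))

nonneg-+-≡0 : ∀ {a b} → 0ℤ ≤ᶻ a → 0ℤ ≤ᶻ b → a +ᶻ b ≡ 0ℤ → a ≡ 0ℤ × b ≡ 0ℤ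
nonneg-+-≡0 {a} {b} 0≤a 0≤b a+b≡0 = ℤₚ.≤-antisym a≤0 0≤a , ℤₚ.≤-antisym b≤0 0≤b
  where
  a≤0 : a ≤ᶻ 0ℤ
  a≤0 = subst₂ _≤ᶻ_ (ℤₚ.+-identityʳ a) a+b≡0 (ℤₚ.+-monoʳ-≤ a 0≤b)
  b≤0 : b ≤ᶻ 0ℤ
  b≤0 = subst₂ _≤ᶻ_ (ℤₚ.+-identityˡ b) a+b≡0 (ℤₚ.+-monoˡ-≤ b 0≤a)

∑-nonneg-≡0 : ∀ {n} {f : Fin n → ℤ} → (∀ i → 0ℤ ≤ᶻ f i) → ∑ f ≡ 0ℤ → ∀ i → f i ≡ 0ℤ
∑-nonneg-≡0 0≤f ∑f≡0 zero    = proj₁ (nonneg-+-≡0 (0≤f zero) (∑-nonneg (0≤f ∘ suc)) ∑f≡0)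
∑-nonneg-≡0 0≤f ∑f≡0 (suc i) =
  ∑-nonneg-≡0 (0≤f ∘ suc) (proj₂ (nonneg-+-≡0 (0≤f zero) (∑-nonneg (0≤f ∘ suc)) ∑f≡0)) i

χ : ∀ {n} → Subset n → Fin n → ℤ
χ p i = if lookup p i then 1ℤ else 0ℤ

χ-∈ : ∀ {n} {p : Subset n} {i} → i ∈ p → χ p i ≡ 1ℤ
χ-∈ i∈p rewrite []=⇒lookup i∈p = refl

χ-∉ : ∀ {n} {p : Subset n} {i} → i ∉ p → χ p i ≡ 0ℤ
χ-∉ {p = p} {i} i∉p with lookup p i in eq
... | true  = contradiction (lookup⇒[]= i p eq) i∉p
... | false = refl

∑-χ : ∀ {n} (p : Subset n) → ∑ (χ p) ≡ + ∣ p ∣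
∑-χ []          = refl
∑-χ (true ∷ p)  = cong (1ℤ +ᶻ_) (∑-χ p)
∑-χ (false ∷ p) = trans (ℤₚ.+-identityˡ _) (∑-χ p)

next-inject₁ : ∀ {m} (j : Fin m) → next {suc m} (inject₁ j) ≡ suc j
next-inject₁ {m} j = Finₚ.toℕ-injective (begin
  toℕ (next (inject₁ j))        ≡⟨ Finₚ.toℕ-fromℕ< _ ⟩
  suc (toℕ (inject₁ j)) % suc m ≡⟨ cong (λ t → suc t % suc m) (Finₚ.toℕ-inject₁ j) ⟩
  suc (toℕ j) % suc m           ≡⟨ m<n⇒m%n≡m (s≤s (Finₚ.toℕ<n j)) ⟩
  suc (toℕ j)                   ∎)
  where open ≡-Reasoning

next-fromℕ : ∀ m → next {suc m} (fromℕ m) ≡ zero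
next-fromℕ m = Finₚ.toℕ-injective (begin
  toℕ (next (fromℕ m))        ≡⟨ Finₚ.toℕ-fromℕ< _ ⟩
  suc (toℕ (fromℕ m)) % suc m ≡⟨ cong (λ t → suc t % suc m) (Finₚ.toℕ-fromℕ m) ⟩
  suc m % suc m                   ≡⟨ n%n≡0 (suc m) ⟩
  0                               ∎)
  where open ≡-Reasoning

next-injective : ∀ {m} {i j : Fin (suc m)} → next i ≡ next j → i ≡ j
next-injective {m} {i} {j} eq with view i | view j
... | ‵fromℕ     | ‵fromℕ     = refl
... | ‵fromℕ     | ‵inject₁ b = contradiction (trans (sym (next-fromℕ m)) (trans eq (next-inject₁ b))) Finₚ.0≢1+n
... | ‵inject₁ a | ‵fromℕ     = contradiction (trans (sym (next-fromℕ m)) (trans (sym eq) (next-inject₁ a)))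
                                              Finₚ.0≢1+n
... | ‵inject₁ a | ‵inject₁ b =
  cong inject₁ (Finₚ.suc-injective (trans (sym (next-inject₁ a)) (trans eq (next-inject₁ b))))

next-surjective : ∀ {m} (v : Fin (suc m)) → ∃ λ j → next j ≡ v
next-surjective {m} zero    = fromℕ m , next-fromℕ m
next-surjective     (suc v) = inject₁ v , next-inject₁ v

∑-next : ∀ {m} (f : Fin (suc m) → ℤ) → ∑ (f ∘ next) ≡ ∑ f
∑-next {m} f = begin
  ∑ (f ∘ next)                                  ≡⟨ ∑-init-last (f ∘ next) ⟩
  ∑ (f ∘ next ∘ inject₁) +ᶻ f (next (fromℕ m)) ≡⟨ cong₂ _+ᶻ_ (∑-cong (cong f ∘ next-inject₁))
                                                               (cong f (next-fromℕ m)) ⟩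
  ∑ (f ∘ suc) +ᶻ f zero                         ≡⟨ ℤₚ.+-comm _ (f zero) ⟩
  ∑ f                                           ∎
  where open ≡-Reasoning

-- Linear functionals on the generating points

δ-refl : ∀ {n} (v : Fin n) → δ v v ≡ 1ℤ
δ-refl v with v Fin.≟ v
... | yes _   = refl
... | no v≢v = contradiction refl v≢v

δ-≢ : ∀ {n} {v w : Fin n} → v ≢ w → δ v w ≡ 0ℤ
δ-≢ {v = v} {w} v≢w with v Fin.≟ w
... | yes v≡w = contradiction v≡w v≢w
... | no _    = refl

δ-sym : ∀ {n} (v w : Fin n) → δ v w ≡ δ w v
δ-sym v w with v Fin.≟ w | w Fin.≟ v
... | yes _   | yes _   = refl
... | no _    | no _    = refl
... | yes v≡w | no w≢v = contradiction (sym v≡w) w≢v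
... | no v≢w | yes w≡v = contradiction (sym w≡v) v≢w

δ-next : ∀ {m} (v w : Fin (suc m)) → δ (next v) (next w) ≡ δ v w
δ-next v w with v Fin.≟ w
... | yes refl = δ-refl (next v)
... | no v≢w  = δ-≢ (v≢w ∘ next-injective)

∑-δ : ∀ {n} (f : Fin n → ℤ) (w : Fin n) → ∑ (λ v → f v *ᶻ δ v w) ≡ f w
∑-δ f w = begin
  ∑ (λ v → f v *ᶻ δ v w) ≡⟨ ∑-single _ w (λ v v≢w → trans (cong (f v *ᶻ_) (δ-≢ v≢w)) (ℤₚ.*-zeroʳ (f v))) ⟩
  f w *ᶻ δ w w           ≡⟨ trans (cong (f w *ᶻ_) (δ-refl w)) (ℤₚ.*-identityʳ (f w)) ⟩
  f w                    ∎
  where open ≡-Reasoning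

∑-δ-difference : ∀ {n} (f : Fin n → ℤ) (a b : Fin n) →
                 ∑ (λ v → f v *ᶻ (δ v a -ᶻ δ v b)) ≡ f a -ᶻ f b
∑-δ-difference f a b = begin
  ∑ (λ v → f v *ᶻ (δ v a -ᶻ δ v b))            ≡⟨ ∑-cong (λ v → distrib (f v) (δ v a) (δ v b)) ⟩
  ∑ (λ v → f v *ᶻ δ v a -ᶻ f v *ᶻ δ v b)       ≡⟨ ∑-distrib-- (λ v → f v *ᶻ δ v a) (λ v → f v *ᶻ δ v b) ⟩
  ∑ (λ v → f v *ᶻ δ v a) -ᶻ ∑ (λ v → f v *ᶻ δ v b) ≡⟨ cong₂ _-ᶻ_ (∑-δ f a) (∑-δ f b) ⟩
  f a -ᶻ f b                                   ∎
  where
  open ≡-Reasoning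
  distrib : ∀ x y z → x *ᶻ (y -ᶻ z) ≡ x *ᶻ y -ᶻ x *ᶻ z
  distrib = solve-∀

∂ : ∀ {n} → (Fin n → ℤ) → Fin n → ℤ
∂ c i = c i -ᶻ c (next i)

∑-∂ : ∀ {m} (c : Fin (suc m) → ℤ) → ∑ (∂ c) ≡ 0ℤ
∑-∂ c = begin
  ∑ (∂ c)              ≡⟨ ∑-distrib-- c (c ∘ next) ⟩
  ∑ c -ᶻ ∑ (c ∘ next)  ≡⟨ cong (∑ c -ᶻ_) (∑-next c) ⟩
  ∑ c -ᶻ ∑ c           ≡⟨ ℤₚ.+-inverseʳ (∑ c) ⟩
  0ℤ                   ∎
  where open ≡-Reasoning

edgeValue : ∀ {n} → (Fin n → ℤ) → Pt n → ℤ
edgeValue d (i , true)  = d i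
edgeValue d (i , false) = - d i

⟨-,point⟩≡edgeValue-∂ : ∀ {n} (c : Fin n → ℤ) x → ⟨ c , point x ⟩ ≡ edgeValue (∂ c) x
⟨-,point⟩≡edgeValue-∂ c (i , true)  = ∑-δ-difference c i (next i)
⟨-,point⟩≡edgeValue-∂ c (i , false) =
  trans (∑-δ-difference c (next i) i) (swap (c i) (c (next i)))
  where
  swap : ∀ x y → y -ᶻ x ≡ - (x -ᶻ y)
  swap = solve-∀

edgeValue-cong : ∀ {n} {d d′ : Fin n → ℤ} → (∀ i → d i ≡ d′ i) → ∀ x → edgeValue d x ≡ edgeValue d′ x
edgeValue-cong d≗d′ (i , true)  = d≗d′ i
edgeValue-cong d≗d′ (i , false) = cong -_ (d≗d′ i)

prefixSum : ∀ {n} → (Fin n → ℤ) → Fin (suc n) → ℤ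
prefixSum f       zero    = 0ℤ
prefixSum {suc n} f (suc i) = f zero +ᶻ prefixSum (f ∘ suc) i

prefixSum-suc : ∀ {n} (f : Fin n → ℤ) j → prefixSum f (suc j) ≡ prefixSum f (inject₁ j) +ᶻ f j
prefixSum-suc f zero    = trans (ℤₚ.+-identityʳ (f zero)) (sym (ℤₚ.+-identityˡ (f zero)))
prefixSum-suc f (suc j) = trans (cong (f zero +ᶻ_) (prefixSum-suc (f ∘ suc) j))
                                (sym (ℤₚ.+-assoc (f zero) (prefixSum (f ∘ suc) (inject₁ j)) (f (suc j))))

prefixSum-fromℕ : ∀ {n} (f : Fin n → ℤ) → prefixSum f (fromℕ n) ≡ ∑ f
prefixSum-fromℕ {zero}  f = refl
prefixSum-fromℕ {suc n} f = cong (f zero +ᶻ_) (prefixSum-fromℕ (f ∘ suc))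

prefixSum-next : ∀ {m} (d : Fin (suc m) → ℤ) → ∑ d ≡ 0ℤ →
                 ∀ i → prefixSum d (inject₁ (next i)) ≡ prefixSum d (inject₁ i) +ᶻ d i
prefixSum-next {m} d ∑d≡0 i with view i
... | ‵inject₁ j = trans (cong (prefixSum d ∘ inject₁) (next-inject₁ j)) (prefixSum-suc d (inject₁ j))
... | ‵fromℕ     = begin
  prefixSum d (inject₁ (next (fromℕ m)))       ≡⟨ cong (prefixSum d ∘ inject₁) (next-fromℕ m) ⟩
  0ℤ                                           ≡⟨ ∑d≡0 ⟨
  ∑ d                                          ≡⟨ prefixSum-fromℕ d ⟨
  prefixSum d (suc (fromℕ m))                  ≡⟨ prefixSum-suc d (fromℕ m) ⟩
  prefixSum d (inject₁ (fromℕ m)) +ᶻ d (fromℕ m) ∎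
  where open ≡-Reasoning

∂-surjective : ∀ {m} (d : Fin (suc m) → ℤ) → ∑ d ≡ 0ℤ → ∃ λ c → ∀ i → ∂ c i ≡ d i
∂-surjective {m} d ∑d≡0 =
  c , λ i → trans (cong (c i -ᶻ_) (cong -_ (prefixSum-next d ∑d≡0 i))) (cancel (prefixSum d (inject₁ i)) (d i))
  where
  c : Fin (suc m) → ℤ
  c v = - prefixSum d (inject₁ v)
  cancel : ∀ p x → - p -ᶻ - (p +ᶻ x) ≡ x
  cancel = solve-∀

-- Affine dependences among the generating points

net : ∀ {n} → (Pt n → ℤ) → Fin n → ℤ
net μ i = μ (i , true) -ᶻ μ (i , false)

combination : ∀ {n} → (Pt n → ℤ) → Fin n → ℤ
combination μ v = ∑ₚ (λ x → μ x *ᶻ point x v)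

combination-next : ∀ {m} (μ : Pt (suc m) → ℤ) (j : Fin (suc m)) →
                   combination μ (next j) ≡ net μ (next j) -ᶻ net μ j
combination-next μ j = begin
  combination μ (next j)
    ≡⟨ ∑-cong (λ i → regroup (μ (i , true)) (μ (i , false)) (δ (next j) i) (δ (next j) (next i))) ⟩
  ∑ (λ i → net μ i *ᶻ δ (next j) i -ᶻ net μ i *ᶻ δ (next j) (next i))
    ≡⟨ ∑-distrib-- (λ i → net μ i *ᶻ δ (next j) i) (λ i → net μ i *ᶻ δ (next j) (next i)) ⟩
  ∑ (λ i → net μ i *ᶻ δ (next j) i) -ᶻ ∑ (λ i → net μ i *ᶻ δ (next j) (next i))
    ≡⟨ cong₂ _-ᶻ_ (∑-cong λ i → cong (net μ i *ᶻ_) (δ-sym (next j) i))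
                  (∑-cong λ i → cong (net μ i *ᶻ_) (trans (δ-next j i) (δ-sym j i))) ⟩
  ∑ (λ i → net μ i *ᶻ δ i (next j)) -ᶻ ∑ (λ i → net μ i *ᶻ δ i j)
    ≡⟨ cong₂ _-ᶻ_ (∑-δ (net μ) (next j)) (∑-δ (net μ) j) ⟩
  net μ (next j) -ᶻ net μ j
    ∎
  where
  open ≡-Reasoning
  regroup : ∀ t f a b → t *ᶻ (a -ᶻ b) +ᶻ f *ᶻ (b -ᶻ a) ≡ (t -ᶻ f) *ᶻ a -ᶻ (t -ᶻ f) *ᶻ b
  regroup = solve-∀

constant-by-steps : ∀ {a} {A : Set a} {m} (h : Fin (suc m) → A) →
                    (∀ j → h (suc j) ≡ h (inject₁ j)) → ∀ i → h i ≡ h zero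
constant-by-steps h step zero = refl
constant-by-steps {m = suc m} h step (suc j) =
  trans (step j) (constant-by-steps (h ∘ inject₁) (step ∘ inject₁) j)

net-constant : ∀ {m} (μ : Pt (suc m) → ℤ) → (∀ v → combination μ v ≡ 0ℤ) → ∀ i j → net μ i ≡ net μ j
net-constant μ μ-rel i j = trans (net≡net₀ i) (sym (net≡net₀ j))
  where
  step : ∀ j → net μ (suc j) ≡ net μ (inject₁ j)
  step j = trans (cong (net μ) (sym (next-inject₁ j)))
    (ℤₚ.i-j≡0⇒i≡j _ _ (trans (sym (combination-next μ (inject₁ j))) (μ-rel (next (inject₁ j)))))
  net≡net₀ : ∀ i → net μ i ≡ net μ zero
  net≡net₀ = constant-by-steps (net μ) step

combination-of-constant-net : ∀ {m} (μ : Pt (suc m) → ℤ) (c : ℤ) → (∀ i → net μ i ≡ c) →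
                              ∀ v → combination μ v ≡ 0ℤ
combination-of-constant-net μ c net≡c v with next-surjective v
... | j , refl = trans (combination-next μ j) (trans (cong₂ _-ᶻ_ (net≡c (next j)) (net≡c j)) (ℤₚ.+-inverseʳ c))

disjoint⇒∉ : ∀ {n} {P N : Subset n} {i} → Empty (P ∩ N) → i ∈ P → i ∉ N
disjoint⇒∉ P∩N≡∅ i∈P i∈N = P∩N≡∅ (_ , x∈p∩q⁺ (i∈P , i∈N))

∉⇒disjoint : ∀ {n} {P N : Subset n} → (∀ {i} → i ∈ P → i ∉ N) → Empty (P ∩ N)
∉⇒disjoint {P = P} {N} P∌N (_ , i∈P∩N) = let i∈P , i∈N = x∈p∩q⁻ P N i∈P∩N in P∌N i∈P i∈N

∣p∣<∣q∣⇒∃∈q∖p : ∀ {n} {p q : Subset n} → ∣ p ∣ < ∣ q ∣ → ∃ λ i → i ∈ q × i ∉ p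
∣p∣<∣q∣⇒∃∈q∖p {p = p} {q} ∣p∣<∣q∣ with any? (λ i → i ∈? q ×-dec ¬? (i ∈? p))
... | yes witness = witness
... | no ∄ = contradiction (p⊆q⇒∣p∣≤∣q∣ q⊆p) (ℕₚ.<⇒≱ ∣p∣<∣q∣)
  where
  q⊆p : q ⊆ p
  q⊆p {i} i∈q with i ∈? p
  ... | yes i∈p = i∈p
  ... | no i∉p  = contradiction (i , i∈q , i∉p) ∄

∣∣+∣∣<n⇒gap : ∀ {n} (P N : Subset n) → ∣ P ∣ + ∣ N ∣ < n → ∃ λ i → i ∉ P × i ∉ N
∣∣+∣∣<n⇒gap {n} P N small = let i , i∈∁P , i∉N = ∣p∣<∣q∣⇒∃∈q∖p ∣N∣<∣∁P∣ in i , x∈∁p⇒x∉p i∈∁P , i∉N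
  where
  ∣N∣<∣∁P∣ : ∣ N ∣ < ∣ ∁ P ∣
  ∣N∣<∣∁P∣ = subst (∣ N ∣ <_) (sym (∣∁p∣≡n∸∣p∣ P))
    (ℕₚ.+-cancelˡ-< ∣ P ∣ _ _ (subst (∣ P ∣ + ∣ N ∣ <_) (sym (ℕₚ.m+[n∸m]≡n (∣p∣≤n P))) small))

gap⇒∣∣+∣∣<n : ∀ {n} {P N : Subset n} {i} → Empty (P ∩ N) → i ∉ P → i ∉ N → ∣ P ∣ + ∣ N ∣ < n
gap⇒∣∣+∣∣<n {n} {P} {N} {i} P∩N≡∅ i∉P i∉N = begin-strict
  ∣ P ∣ + ∣ N ∣         <⟨ ℕₚ.+-monoʳ-< ∣ P ∣ (p⊂q⇒∣p∣<∣q∣ N⊂∁P) ⟩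
  ∣ P ∣ + ∣ ∁ P ∣       ≡⟨ cong (_+_ ∣ P ∣) (∣∁p∣≡n∸∣p∣ P) ⟩
  ∣ P ∣ + (n ∸ ∣ P ∣)   ≡⟨ ℕₚ.m+[n∸m]≡n (∣p∣≤n P) ⟩
  n                     ∎
  where
  open ℕₚ.≤-Reasoning
  N⊂∁P : N ⊂ ∁ P
  N⊂∁P = (λ i∈N → x∉p⇒x∈∁p (λ i∈P → disjoint⇒∉ P∩N≡∅ i∈P i∈N)) , i , x∉p⇒x∈∁p i∉P , i∉N

disjoint-covering : ∀ {n} {P N : Subset n} → Empty (P ∩ N) → ∣ P ∣ + ∣ N ∣ ≡ n → ∀ i → i ∈ P ⊎ i ∈ N
disjoint-covering {P = P} {N} P∩N≡∅ ∣P∣+∣N∣≡n i with i ∈? P | i ∈? N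
... | yes i∈P | _       = inj₁ i∈P
... | no _    | yes i∈N = inj₂ i∈N
... | no i∉P  | no i∉N  = contradiction ∣P∣+∣N∣≡n (ℕₚ.<⇒≢ (gap⇒∣∣+∣∣<n P∩N≡∅ i∉P i∉N))

affIndep-of-gap : ∀ {n} {P N : Subset n} {i₀} → Empty (P ∩ N) → i₀ ∉ P → i₀ ∉ N → AffIndep (P , N)
affIndep-of-gap {suc _} {P} {N} {i₀} P∩N≡∅ i₀∉P i₀∉N μ μ-off _ μ-rel = μ≡0
  where
  net≡0 : ∀ i → net μ i ≡ 0ℤ
  net≡0 i = trans (net-constant μ μ-rel i i₀) (cong₂ _-ᶻ_ (μ-off (i₀ , true) i₀∉P) (μ-off (i₀ , false) i₀∉N))
  balanced : ∀ i → μ (i , true) ≡ μ (i , false)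
  balanced i = ℤₚ.i-j≡0⇒i≡j _ _ (net≡0 i)
  μ≡0 : ∀ x → μ x ≡ 0ℤ
  μ≡0 (i , true) with i ∈? P
  ... | no i∉P  = μ-off (i , true) i∉P
  ... | yes i∈P = trans (balanced i) (μ-off (i , false) (disjoint⇒∉ P∩N≡∅ i∈P))
  μ≡0 (i , false) with i ∈? N
  ... | no i∉N  = μ-off (i , false) i∉N
  ... | yes i∈N = trans (sym (balanced i)) (μ-off (i , true) (λ i∈P → disjoint⇒∉ P∩N≡∅ i∈P i∈N))

partition-dependent : ∀ {m} {P N : Subset (suc m)} → Empty (P ∩ N) → (∀ i → i ∈ P ⊎ i ∈ N) →
                      ∣ P ∣ ≡ ∣ N ∣ → ¬ AffIndep (P , N)
partition-dependent {m} {P} {N} P∩N≡∅ covering ∣P∣≡∣N∣ indep =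
  [ (λ 0∈P → contradiction (trans (sym (χ-∈ 0∈P)) (μ≡0 (zero , true))) λ ())
  , (λ 0∈N → contradiction (trans (cong -_ (sym (χ-∈ 0∈N))) (μ≡0 (zero , false))) λ ())
  ] (covering zero)
  where
  μ : Pt (suc m) → ℤ
  μ (i , true)  = χ P i
  μ (i , false) = - χ N i
  μ-off : ∀ x → ¬ (x ∈ₚ (P , N)) → μ x ≡ 0ℤ
  μ-off (i , true)  i∉P = χ-∉ i∉P
  μ-off (i , false) i∉N = cong -_ (χ-∉ i∉N)
  ∑μ≡0 : ∑ₚ μ ≡ 0ℤ
  ∑μ≡0 = begin
    ∑ (λ i → χ P i -ᶻ χ N i)    ≡⟨ ∑-distrib-- (χ P) (χ N) ⟩
    ∑ (χ P) -ᶻ ∑ (χ N)          ≡⟨ cong₂ _-ᶻ_ (∑-χ P) (∑-χ N) ⟩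
    + ∣ P ∣ -ᶻ + ∣ N ∣          ≡⟨ cong (λ t → + t -ᶻ + ∣ N ∣) ∣P∣≡∣N∣ ⟩
    + ∣ N ∣ -ᶻ + ∣ N ∣          ≡⟨ ℤₚ.+-inverseʳ (+ ∣ N ∣) ⟩
    0ℤ                          ∎
    where open ≡-Reasoning
  net≡1 : ∀ i → net μ i ≡ 1ℤ
  net≡1 i with covering i
  ... | inj₁ i∈P = cong₂ (λ a b → a -ᶻ - b) (χ-∈ i∈P) (χ-∉ (disjoint⇒∉ P∩N≡∅ i∈P))
  ... | inj₂ i∈N = cong₂ (λ a b → a -ᶻ - b) (χ-∉ (λ i∈P → disjoint⇒∉ P∩N≡∅ i∈P i∈N)) (χ-∈ i∈N)
  μ≡0 : ∀ x → μ x ≡ 0ℤ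
  μ≡0 = indep μ μ-off ∑μ≡0 (combination-of-constant-net μ 1ℤ net≡1)

x+x≡0⇒x≡0 : ∀ {x} → x +ᶻ x ≡ 0ℤ → x ≡ 0ℤ
x+x≡0⇒x≡0 {+ zero}    _  = refl
x+x≡0⇒x≡0 {+ suc n}   ()
x+x≡0⇒x≡0 { -[1+ n ]} ()

spanningSet : ∀ m → PtSet (suc (suc m))
spanningSet m = outside ∷ ⊤ , ⁅ suc zero ⁆

∣spanningSet∣ : ∀ m → ∣ spanningSet m ∣ₚ ≡ suc (suc m)
∣spanningSet∣ m = trans (cong₂ _+_ (∣⊤∣≡n (suc m)) (∣⁅x⁆∣≡1 {suc (suc m)} (suc zero))) (ℕₚ.+-comm (suc m) 1)

affIndep-spanningSet : ∀ m → AffIndep (spanningSet m)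
affIndep-spanningSet m μ μ-off ∑μ≡0 μ-rel = μ≡0
  where
  one : Fin (suc (suc m))
  one = suc zero
  balanced : ∀ i → μ (i , true) ≡ μ (i , false)
  balanced i = ℤₚ.i-j≡0⇒i≡j _ _ (trans (net-constant μ μ-rel i zero)
    (cong₂ _-ᶻ_ (μ-off (zero , true) λ ()) (μ-off (zero , false) (x≢y⇒x∉⁅y⁆ {y = one} Finₚ.0≢1+n))))
  μ-false≡0 : ∀ i → i ≢ one → μ (i , false) ≡ 0ℤ
  μ-false≡0 i i≢1 = μ-off (i , false) (x≢y⇒x∉⁅y⁆ {y = one} i≢1)
  twice≡0 : μ (one , false) +ᶻ μ (one , false) ≡ 0ℤ
  twice≡0 = begin
    μ (one , false) +ᶻ μ (one , false) ≡⟨ cong (_+ᶻ μ (one , false)) (balanced one) ⟨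
    μ (one , true) +ᶻ μ (one , false)  ≡⟨ ∑-single (λ i → μ (i , true) +ᶻ μ (i , false)) one (λ i i≢1 →
                                            cong₂ _+ᶻ_ (trans (balanced i) (μ-false≡0 i i≢1)) (μ-false≡0 i i≢1)) ⟨
    ∑ₚ μ                               ≡⟨ ∑μ≡0 ⟩
    0ℤ                                 ∎
    where open ≡-Reasoning
  μ-one≡0 : μ (one , false) ≡ 0ℤ
  μ-one≡0 = x+x≡0⇒x≡0 twice≡0
  μ≡0 : ∀ x → μ x ≡ 0ℤ
  μ≡0 (i , false) with i Fin.≟ one
  ... | yes refl = μ-one≡0
  ... | no i≢1   = μ-false≡0 i i≢1
  μ≡0 (i , true) = trans (balanced i) (μ≡0 (i , false))

∣∣ₚ-mono : ∀ {n} {T S : PtSet n} → T ⊆ₚ S → ∣ T ∣ₚ ≤ ∣ S ∣ₚ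
∣∣ₚ-mono (T⁺⊆S⁺ , T⁻⊆S⁻) = ℕₚ.+-mono-≤ (p⊆q⇒∣p∣≤∣q∣ T⁺⊆S⁺) (p⊆q⇒∣p∣≤∣q∣ T⁻⊆S⁻)

DimSuc-unique : ∀ {n} {S : PtSet n} {i j} → DimSuc S i → DimSuc S j → i ≡ j
DimSuc-unique {i = i} {j} ((T , T⊆S , T-indep , ∣T∣≡i) , maxᵢ) ((U , U⊆S , U-indep , ∣U∣≡j) , maxⱼ) =
  ℕₚ.≤-antisym (subst (_≤ j) ∣T∣≡i (maxⱼ T T⊆S T-indep)) (subst (_≤ i) ∣U∣≡j (maxᵢ U U⊆S U-indep))

DimSuc-of-affIndep : ∀ {n} {S : PtSet n} → AffIndep S → DimSuc S ∣ S ∣ₚ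
DimSuc-of-affIndep S-indep = (_ , (id , id) , S-indep , refl) , λ _ T⊆S _ → ∣∣ₚ-mono T⊆S

DimSuc-of-full : ∀ {n} {S : PtSet n} {j} → 2 ≤ n → FullPt S → DimSuc S j → n ≤ j
DimSuc-of-full {suc zero} (s≤s ()) _ _
DimSuc-of-full {suc (suc m)} {j = j} _ full (_ , maxⱼ) =
  subst (_≤ j) (∣spanningSet∣ m)
    (maxⱼ (spanningSet m) ((λ {i} _ → full (i , true)) , (λ {i} _ → full (i , false))) (affIndep-spanningSet m))

DimSuc-of-small : ∀ {n} {A B : Subset n} → Empty (A ∩ B) → ∣ A ∣ + ∣ B ∣ < n → DimSuc (A , B) (∣ A ∣ + ∣ B ∣)
DimSuc-of-small {A = A} {B} A∩B≡∅ small =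
  let _ , i∉A , i∉B = ∣∣+∣∣<n⇒gap A B small in DimSuc-of-affIndep (affIndep-of-gap A∩B≡∅ i∉A i∉B)

summands-equal : ∀ {a b c d} → a ≤ c → b ≤ d → a + b ≡ c + d → a ≡ c
summands-equal a≤c b≤d a+b≡c+d with ℕₚ.m≤n⇒m<n∨m≡n a≤c
... | inj₁ a<c = contradiction a+b≡c+d (ℕₚ.<⇒≢ (ℕₚ.+-mono-<-≤ a<c b≤d))
... | inj₂ a≡c = a≡c

∣∣+∣∣-tail : ∀ {m s} a b (A B : Subset m) → Empty ((a ∷ A) ∩ (b ∷ B)) → zero ∈ (a ∷ A) ⊎ zero ∈ (b ∷ B) →
             ∣ a ∷ A ∣ + ∣ b ∷ B ∣ ≡ suc s → ∣ A ∣ + ∣ B ∣ ≡ s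
∣∣+∣∣-tail true  true  A B A∩B≡∅ _ _ = contradiction here (disjoint⇒∉ A∩B≡∅ here)
∣∣+∣∣-tail true  false A B _ _ ∣A∣+∣B∣≡1+s = ℕₚ.suc-injective ∣A∣+∣B∣≡1+s
∣∣+∣∣-tail false true  A B _ _ ∣A∣+∣B∣≡1+s = ℕₚ.suc-injective (trans (sym (ℕₚ.+-suc ∣ A ∣ ∣ B ∣)) ∣A∣+∣B∣≡1+s)
∣∣+∣∣-tail false false A B _ (inj₁ ()) _
∣∣+∣∣-tail false false A B _ (inj₂ ()) _

affIndep-in-partition : ∀ {m} {A B : Subset (suc m)} → Empty (A ∩ B) → ∣ A ∣ ≡ ∣ B ∣ → ∣ A ∣ + ∣ B ∣ ≡ suc m →
                        ∀ {U} → U ⊆ₚ (A , B) → AffIndep U → ∣ U ∣ₚ ≤ m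
affIndep-in-partition {A = A} {B} A∩B≡∅ ∣A∣≡∣B∣ ∣A∣+∣B∣≡n {P , N} (P⊆A , N⊆B) U-indep
  with ℕₚ.m≤n⇒m<n∨m≡n (subst (∣ P ∣ + ∣ N ∣ ≤_) ∣A∣+∣B∣≡n (∣∣ₚ-mono (P⊆A , N⊆B)))
... | inj₁ ∣U∣<n = ℕ.s≤s⁻¹ ∣U∣<n
... | inj₂ ∣U∣≡n = contradiction U-indep (partition-dependent P∩N≡∅ (disjoint-covering P∩N≡∅ ∣U∣≡n) ∣P∣≡∣N∣)
  where
  P∩N≡∅ : Empty (P ∩ N)
  P∩N≡∅ = ∉⇒disjoint (λ i∈P i∈N → disjoint⇒∉ A∩B≡∅ (P⊆A i∈P) (N⊆B i∈N))
  ∣P∣+∣N∣≡∣A∣+∣B∣ : ∣ P ∣ + ∣ N ∣ ≡ ∣ A ∣ + ∣ B ∣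
  ∣P∣+∣N∣≡∣A∣+∣B∣ = trans ∣U∣≡n (sym ∣A∣+∣B∣≡n)
  ∣P∣≡∣A∣ : ∣ P ∣ ≡ ∣ A ∣
  ∣P∣≡∣A∣ = summands-equal (p⊆q⇒∣p∣≤∣q∣ P⊆A) (p⊆q⇒∣p∣≤∣q∣ N⊆B) ∣P∣+∣N∣≡∣A∣+∣B∣
  ∣N∣≡∣B∣ : ∣ N ∣ ≡ ∣ B ∣
  ∣N∣≡∣B∣ = ℕₚ.+-cancelˡ-≡ ∣ P ∣ _ _ (trans ∣P∣+∣N∣≡∣A∣+∣B∣ (cong (_+ ∣ B ∣) (sym ∣P∣≡∣A∣)))
  ∣P∣≡∣N∣ : ∣ P ∣ ≡ ∣ N ∣
  ∣P∣≡∣N∣ = trans ∣P∣≡∣A∣ (trans ∣A∣≡∣B∣ (sym ∣N∣≡∣B∣))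

DimSuc-of-partition : ∀ {m} {A B : Subset (suc m)} → Empty (A ∩ B) → ∣ A ∣ ≡ ∣ B ∣ → ∣ A ∣ + ∣ B ∣ ≡ suc m →
                      DimSuc (A , B) m
DimSuc-of-partition {m} {a ∷ A} {b ∷ B} A∩B≡∅ ∣A∣≡∣B∣ ∣A∣+∣B∣≡n =
  (S₀ , S₀⊆AB , S₀-indep , ∣S₀∣≡m) , λ _ → affIndep-in-partition A∩B≡∅ ∣A∣≡∣B∣ ∣A∣+∣B∣≡n
  where
  S₀ : PtSet (suc m)
  S₀ = outside ∷ A , outside ∷ B
  S₀⊆AB : S₀ ⊆ₚ (a ∷ A , b ∷ B)
  S₀⊆AB = (λ { (there i∈A) → there i∈A }) , (λ { (there i∈B) → there i∈B })
  S₀-indep : AffIndep S₀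
  S₀-indep = affIndep-of-gap {i₀ = zero}
    (∉⇒disjoint λ i∈A i∈B → disjoint⇒∉ A∩B≡∅ (proj₁ S₀⊆AB i∈A) (proj₂ S₀⊆AB i∈B)) (λ ()) (λ ())
  ∣S₀∣≡m : ∣ S₀ ∣ₚ ≡ m
  ∣S₀∣≡m = ∣∣+∣∣-tail a b A B A∩B≡∅ (disjoint-covering A∩B≡∅ ∣A∣+∣B∣≡n zero) ∣A∣+∣B∣≡n

-- Faces as top level sets of edge values

IsTopLevel : ∀ {n} → (Fin n → ℤ) → ℤ → PtSet n → Set
IsTopLevel d M S = (∀ y → edgeValue d y ≤ᶻ M) × (∀ x → (x ∈ₚ S) ⇔ (edgeValue d x ≡ M))

maximiser : ∀ {m} (f : Pt (suc m) → ℤ) → ∃ λ y → ∀ x → f x ≤ᶻ f y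
maximiser {m} f =
  argmax f (zero , true) points , λ x → All.lookup (f[xs]≤f[argmax] {f = f} (zero , true) points) (∈-points x)
  where
  open Extrema ℤₚ.≤-totalOrder
  points : List (Pt (suc m))
  points = cartesianProduct (allFin (suc m)) (true ∷ false ∷ [])
  ∈-points : ∀ x → x ∈ₗ points
  ∈-points (i , true)  = ∈-cartesianProduct⁺ (∈-allFin i) (here refl)
  ∈-points (i , false) = ∈-cartesianProduct⁺ (∈-allFin i) (there (here refl))

exposed⇒topLevel : ∀ {m} {S : PtSet (suc m)} → IsExposed S →
                   Σ (Fin (suc m) → ℤ) λ d → ∑ d ≡ 0ℤ × Σ ℤ λ M → IsTopLevel d M S
exposed⇒topLevel {m} {S} (c , exposes) = ∂ c , ∑-∂ c , value y₀ , y₀-max , λ x → mk⇔ (to x) (from x)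
  where
  value : Pt (suc m) → ℤ
  value = edgeValue (∂ c)
  ⟨c,-⟩≡value : ∀ x → ⟨ c , point x ⟩ ≡ value x
  ⟨c,-⟩≡value = ⟨-,point⟩≡edgeValue-∂ c
  y₀ : Pt (suc m)
  y₀ = proj₁ (maximiser value)
  y₀-max : ∀ x → value x ≤ᶻ value y₀
  y₀-max = proj₂ (maximiser value)
  to : ∀ x → x ∈ₚ S → value x ≡ value y₀
  to x x∈S = ℤₚ.≤-antisym (y₀-max x)
    (subst₂ _≤ᶻ_ (⟨c,-⟩≡value y₀) (⟨c,-⟩≡value x) (Equivalence.to (exposes x) x∈S y₀))
  from : ∀ x → value x ≡ value y₀ → x ∈ₚ S
  from x x-max = Equivalence.from (exposes x) λ y →
    subst₂ _≤ᶻ_ (sym (⟨c,-⟩≡value y)) (sym (trans (⟨c,-⟩≡value x) x-max)) (y₀-max y)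

topLevel⇒exposed : ∀ {n} {S : PtSet n} (d : Fin n → ℤ) {M} → ∑ d ≡ 0ℤ → IsTopLevel d M S →
                   (∃ λ x → x ∈ₚ S) → IsExposed S
topLevel⇒exposed {zero} _ _ _ ((() , _) , _)
topLevel⇒exposed {suc m} {S} d {M} ∑d≡0 (bounded , level) (x₀ , x₀∈S) with ∂-surjective d ∑d≡0
... | c , ∂c≡d = c , λ x → mk⇔ (to x) (from x)
  where
  ⟨c,-⟩≡value : ∀ x → ⟨ c , point x ⟩ ≡ edgeValue d x
  ⟨c,-⟩≡value x = trans (⟨-,point⟩≡edgeValue-∂ c x) (edgeValue-cong ∂c≡d x)
  ⟨c,-⟩≡M : ∀ {x} → x ∈ₚ S → ⟨ c , point x ⟩ ≡ M
  ⟨c,-⟩≡M {x} x∈S = trans (⟨c,-⟩≡value x) (Equivalence.to (level x) x∈S)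
  to : ∀ x → x ∈ₚ S → ∀ y → ⟨ c , point y ⟩ ≤ᶻ ⟨ c , point x ⟩
  to x x∈S y = subst₂ _≤ᶻ_ (sym (⟨c,-⟩≡value y)) (sym (⟨c,-⟩≡M x∈S)) (bounded y)
  from : ∀ x → (∀ y → ⟨ c , point y ⟩ ≤ᶻ ⟨ c , point x ⟩) → x ∈ₚ S
  from x x-max = Equivalence.from (level x)
    (ℤₚ.≤-antisym (bounded x) (subst₂ _≤ᶻ_ (⟨c,-⟩≡M x₀∈S) (⟨c,-⟩≡value x) (x-max x₀)))

∑-1-2χ : ∀ {n} (A : Subset n) → ∑ (λ i → 1ℤ -ᶻ + 2 *ᶻ χ A i) ≡ + n -ᶻ + 2 *ᶻ + ∣ A ∣
∑-1-2χ {n} A = begin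
  ∑ (λ i → 1ℤ -ᶻ + 2 *ᶻ χ A i)                 ≡⟨ ∑-distrib-- (λ _ → 1ℤ) (λ i → + 2 *ᶻ χ A i) ⟩
  ∑ {n} (λ _ → 1ℤ) -ᶻ ∑ (λ i → + 2 *ᶻ χ A i)   ≡⟨ cong₂ _-ᶻ_ (∑-const-1 n) (∑-*ˡ (+ 2) (χ A)) ⟩
  + n -ᶻ + 2 *ᶻ ∑ (χ A)                        ≡⟨ cong (λ s → + n -ᶻ + 2 *ᶻ s) (∑-χ A) ⟩
  + n -ᶻ + 2 *ᶻ + ∣ A ∣                        ∎
  where open ≡-Reasoning

-- e i = d i + M (1 - 2 χ_A i) is nonnegative and sums to M (n - 2 ∣A∣) ≤ 0, so both vanish.
max-on-half⇒min-on-rest : ∀ {n} k → n ≡ k + k → (d : Fin n → ℤ) → ∑ d ≡ 0ℤ → ∀ P → (∀ i → - + suc P ≤ᶻ d i) →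
                          ∀ {A : Subset n} → (∀ {i} → i ∈ A → d i ≡ + suc P) → k ≤ ∣ A ∣ →
                          ∣ A ∣ ≡ k × (∀ {i} → i ∉ A → d i ≡ - + suc P)
max-on-half⇒min-on-rest {n} k n≡k+k d ∑d≡0 P -M≤d {A} A⇒M k≤∣A∣ =
  ∣A∣≡k , λ i∉A → ℤₚ.i-j≡0⇒i≡j _ _ (trans (sym (e-off-A i∉A)) (e≡0 _))
  where
  M : ℤ
  M = + suc P
  e : Fin n → ℤ
  e i = d i +ᶻ M *ᶻ (1ℤ -ᶻ + 2 *ᶻ χ A i)
  e-on-A : ∀ {i} → i ∈ A → e i ≡ 0ℤ
  e-on-A {i} i∈A = trans (cong₂ (λ x t → x +ᶻ M *ᶻ (1ℤ -ᶻ + 2 *ᶻ t)) (A⇒M i∈A) (χ-∈ i∈A)) (cancel M)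
    where
    cancel : ∀ x → x +ᶻ x *ᶻ (1ℤ -ᶻ + 2 *ᶻ 1ℤ) ≡ 0ℤ
    cancel = solve-∀
  e-off-A : ∀ {i} → i ∉ A → e i ≡ d i -ᶻ - M
  e-off-A {i} i∉A = trans (cong (λ t → d i +ᶻ M *ᶻ (1ℤ -ᶻ + 2 *ᶻ t)) (χ-∉ i∉A)) (simplify (d i) M)
    where
    simplify : ∀ x y → x +ᶻ y *ᶻ (1ℤ -ᶻ + 2 *ᶻ 0ℤ) ≡ x -ᶻ - y
    simplify = solve-∀
  0≤e : ∀ i → 0ℤ ≤ᶻ e i
  0≤e i with i ∈? A
  ... | yes i∈A = ℤₚ.≤-reflexive (sym (e-on-A i∈A))
  ... | no i∉A  = subst (0ℤ ≤ᶻ_) (sym (e-off-A i∉A)) (ℤₚ.i≤j⇒0≤j-i (-M≤d i))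
  t : ℕ
  t = proj₁ (ℕₚ.m≤n⇒∃[o]m+o≡n k≤∣A∣)
  k+t≡∣A∣ : k + t ≡ ∣ A ∣
  k+t≡∣A∣ = proj₂ (ℕₚ.m≤n⇒∃[o]m+o≡n k≤∣A∣)
  ∑e≡ : ∑ e ≡ - (M *ᶻ (+ 2 *ᶻ + t))
  ∑e≡ = begin
    ∑ e                                         ≡⟨ ∑-distrib-+ d (λ i → M *ᶻ (1ℤ -ᶻ + 2 *ᶻ χ A i)) ⟩
    ∑ d +ᶻ ∑ (λ i → M *ᶻ (1ℤ -ᶻ + 2 *ᶻ χ A i))  ≡⟨ cong₂ _+ᶻ_ ∑d≡0 (∑-*ˡ M (λ i → 1ℤ -ᶻ + 2 *ᶻ χ A i)) ⟩
    0ℤ +ᶻ M *ᶻ ∑ (λ i → 1ℤ -ᶻ + 2 *ᶻ χ A i)     ≡⟨ cong (λ s → 0ℤ +ᶻ M *ᶻ s) (∑-1-2χ A) ⟩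
    0ℤ +ᶻ M *ᶻ (+ n -ᶻ + 2 *ᶻ + ∣ A ∣)           ≡⟨ cong₂ (λ a b → 0ℤ +ᶻ M *ᶻ (a -ᶻ + 2 *ᶻ b)) n≡k+kᶻ ∣A∣≡k+tᶻ ⟩
    0ℤ +ᶻ M *ᶻ ((+ k +ᶻ + k) -ᶻ + 2 *ᶻ (+ k +ᶻ + t)) ≡⟨ rearrange M (+ k) (+ t) ⟩
    - (M *ᶻ (+ 2 *ᶻ + t))                       ∎
    where
    open ≡-Reasoning
    n≡k+kᶻ : + n ≡ + k +ᶻ + k
    n≡k+kᶻ = trans (cong +_ n≡k+k) (ℤₚ.pos-+ k k)
    ∣A∣≡k+tᶻ : + ∣ A ∣ ≡ + k +ᶻ + t
    ∣A∣≡k+tᶻ = trans (cong +_ (sym k+t≡∣A∣)) (ℤₚ.pos-+ k t)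
    rearrange : ∀ m x y → 0ℤ +ᶻ m *ᶻ ((x +ᶻ x) -ᶻ + 2 *ᶻ (x +ᶻ y)) ≡ - (m *ᶻ (+ 2 *ᶻ y))
    rearrange = solve-∀
  t≡0 : t ≡ 0
  t≡0 with t | ∑e≡
  ... | zero  | _    = refl
  ... | suc _ | ∑e<0 = contradiction (subst (0ℤ ≤ᶻ_) ∑e<0 (∑-nonneg 0≤e)) λ ()
  ∣A∣≡k : ∣ A ∣ ≡ k
  ∣A∣≡k = trans (sym k+t≡∣A∣) (trans (cong (_+_ k) t≡0) (ℕₚ.+-identityʳ k))
  e≡0 : ∀ i → e i ≡ 0ℤ
  e≡0 = ∑-nonneg-≡0 0≤e (trans ∑e≡ (trans (cong (λ u → - (M *ᶻ (+ 2 *ᶻ + u))) t≡0) (vanish M)))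
    where
    vanish : ∀ m → - (m *ᶻ (+ 2 *ᶻ 0ℤ)) ≡ 0ℤ
    vanish = solve-∀

complement-size : ∀ {n} {A B : Subset n} → Empty (A ∩ B) → (∀ {i} → i ∉ A → i ∈ B) → ∣ B ∣ ≡ n ∸ ∣ A ∣
complement-size {A = A} {B} A∩B≡∅ ∁A⊆B = trans (ℕₚ.≤-antisym (p⊆q⇒∣p∣≤∣q∣ B⊆∁A) (p⊆q⇒∣p∣≤∣q∣ (∁A⊆B ∘ x∈∁p⇒x∉p)))
                                           (∣∁p∣≡n∸∣p∣ A)
  where
  B⊆∁A : B ⊆ ∁ A
  B⊆∁A i∈B = x∉p⇒x∈∁p (λ i∈A → disjoint⇒∉ A∩B≡∅ i∈A i∈B)

balanced-if-large : ∀ {n} k → n ≡ k + k → (d : Fin n → ℤ) → ∑ d ≡ 0ℤ → ∀ P → (∀ i → - + suc P ≤ᶻ d i) →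
                    ∀ {A B : Subset n} → (∀ {i} → i ∈ A → d i ≡ + suc P) → (∀ {i} → d i ≡ - + suc P → i ∈ B) →
                    Empty (A ∩ B) → k ≤ ∣ A ∣ → ∣ A ∣ ≡ k × ∣ B ∣ ≡ k
balanced-if-large {n} k n≡k+k d ∑d≡0 P -M≤d {A} {B} A⇒M -M⇒B A∩B≡∅ k≤∣A∣ =
  let ∣A∣≡k , rest⇒-M = max-on-half⇒min-on-rest k n≡k+k d ∑d≡0 P -M≤d A⇒M k≤∣A∣ in
  ∣A∣≡k , (begin
    ∣ B ∣     ≡⟨ complement-size A∩B≡∅ (-M⇒B ∘ rest⇒-M) ⟩
    n ∸ ∣ A ∣ ≡⟨ cong₂ _∸_ n≡k+k ∣A∣≡k ⟩
    k + k ∸ k ≡⟨ ℕₚ.m+n∸m≡n k k ⟩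
    k         ∎)
  where open ≡-Reasoning

-edgeValue≤ : ∀ {n} {d : Fin n → ℤ} {M} → (∀ y → edgeValue d y ≤ᶻ M) → ∀ x → - edgeValue d x ≤ᶻ M
-edgeValue≤ bounded (i , true)  = bounded (i , false)
-edgeValue≤ bounded (i , false) = subst (_≤ᶻ _) (sym (ℤₚ.neg-involutive _)) (bounded (i , true))

nonpositive-topLevel-full : ∀ {n} {d : Fin n → ℤ} {M} {S} → M ≤ᶻ 0ℤ → IsTopLevel d M S → FullPt S
nonpositive-topLevel-full {d = d} {M} M≤0 (bounded , level) x = Equivalence.from (level x)
  (ℤₚ.≤-antisym (bounded x) (ℤₚ.≤-trans M≤0 0≤value))
  where
  0≤value : 0ℤ ≤ᶻ edgeValue d x
  0≤value = subst (0ℤ ≤ᶻ_) (ℤₚ.neg-involutive _) (ℤₚ.neg-mono-≤ (ℤₚ.≤-trans (-edgeValue≤ bounded x) M≤0))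

2*k≡k+k : ∀ k → 2 * k ≡ k + k
2*k≡k+k k = cong (_+_ k) (ℕₚ.+-identityʳ k)

sizes-balanced-or-small : ∀ {n} k (A B : Subset n) → (k ≤ ∣ A ∣ → ∣ A ∣ ≡ k × ∣ B ∣ ≡ k) →
                          (k ≤ ∣ B ∣ → ∣ B ∣ ≡ k × ∣ A ∣ ≡ k) →
                          (∣ A ∣ ≡ k × ∣ B ∣ ≡ k) ⊎ (∣ A ∣ < k × ∣ B ∣ < k)
sizes-balanced-or-small k A B large-A large-B with k ℕ.≤? ∣ A ∣ | k ℕ.≤? ∣ B ∣
... | yes k≤∣A∣ | _        = inj₁ (large-A k≤∣A∣)
... | no _     | yes k≤∣B∣ = let ∣B∣≡k , ∣A∣≡k = large-B k≤∣B∣ in inj₁ (∣A∣≡k , ∣B∣≡k)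
... | no k≰∣A∣ | no k≰∣B∣ = inj₂ (ℕₚ.≰⇒> k≰∣A∣ , ℕₚ.≰⇒> k≰∣B∣)

topLevel-classify : ∀ {k} (d : Fin (2 * k) → ℤ) M {S} → ∑ d ≡ 0ℤ → IsTopLevel d M S → FullPt S ⊎ IsGoodPair k S
topLevel-classify d (+ zero)     ∑d≡0 top = inj₁ (nonpositive-topLevel-full (+≤+ z≤n) top)
topLevel-classify d -[1+ _ ]   ∑d≡0 top = inj₁ (nonpositive-topLevel-full -≤+ top)
topLevel-classify {k} d (+ suc P) {A , B} ∑d≡0 (bounded , level) =
  inj₂ (A∩B≡∅ , sizes-balanced-or-small k A B large-A large-B)
  where
  M : ℤ
  M = + suc P
  A⇒M : ∀ {i} → i ∈ A → d i ≡ M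
  A⇒M {i} = Equivalence.to (level (i , true))
  M⇒A : ∀ {i} → d i ≡ M → i ∈ A
  M⇒A {i} = Equivalence.from (level (i , true))
  B⇒-M : ∀ {i} → i ∈ B → - d i ≡ M
  B⇒-M {i} = Equivalence.to (level (i , false))
  -M⇒B : ∀ {i} → - d i ≡ M → i ∈ B
  -M⇒B {i} = Equivalence.from (level (i , false))
  A∩B≡∅ : Empty (A ∩ B)
  A∩B≡∅ = ∉⇒disjoint λ i∈A i∈B → contradiction (trans (cong -_ (sym (A⇒M i∈A))) (B⇒-M i∈B)) λ ()
  large-A : k ≤ ∣ A ∣ → ∣ A ∣ ≡ k × ∣ B ∣ ≡ k
  large-A = balanced-if-large k (2*k≡k+k k) d ∑d≡0 P
              (λ i → subst (- M ≤ᶻ_) (ℤₚ.neg-involutive (d i)) (ℤₚ.neg-mono-≤ (bounded (i , false))))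
              A⇒M (λ d≡-M → -M⇒B (trans (cong -_ d≡-M) (ℤₚ.neg-involutive M))) A∩B≡∅
  large-B : k ≤ ∣ B ∣ → ∣ B ∣ ≡ k × ∣ A ∣ ≡ k
  large-B = balanced-if-large k (2*k≡k+k k) (-_ ∘ d) (trans (∑-neg d) (cong -_ ∑d≡0)) P
              (λ i → ℤₚ.neg-mono-≤ (bounded (i , true)))
              B⇒-M (M⇒A ∘ ℤₚ.neg-injective) (∉⇒disjoint λ i∈B i∈A → disjoint⇒∉ A∩B≡∅ i∈A i∈B)

_∈ₚ?_ : ∀ {n} (x : Pt n) (S : PtSet n) → Dec (x ∈ₚ S)
(i , true)  ∈ₚ? (A , B) = i ∈? A
(i , false) ∈ₚ? (A , B) = i ∈? B

topLevel-of-strict : ∀ {n} {d : Fin n → ℤ} {M} {S} → (∀ {x} → x ∈ₚ S → edgeValue d x ≡ M) →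
                     (∀ {x} → ¬ (x ∈ₚ S) → edgeValue d x <ᶻ M) → IsTopLevel d M S
topLevel-of-strict {d = d} {M} {S} on-S off-S = bounded , λ x → mk⇔ on-S (on-level x)
  where
  bounded : ∀ y → edgeValue d y ≤ᶻ M
  bounded y with y ∈ₚ? S
  ... | yes y∈S = ℤₚ.≤-reflexive (on-S y∈S)
  ... | no y∉S  = ℤₚ.<⇒≤ (off-S y∉S)
  on-level : ∀ x → edgeValue d x ≡ M → x ∈ₚ S
  on-level x x≡M with x ∈ₚ? S
  ... | yes x∈S = x∈S
  ... | no x∉S  = contradiction x≡M (ℤₚ.<⇒≢ (off-S x∉S))

levelPattern : ∀ {n} → Subset n → Subset n → ℤ → ℤ → Fin n → ℤ
levelPattern A B M q i = M *ᶻ (χ A i -ᶻ χ B i) +ᶻ q *ᶻ (1ℤ -ᶻ χ A i -ᶻ χ B i)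

levelPattern-value : ∀ {n} (A B : Subset n) M q i {a b} → χ A i ≡ a → χ B i ≡ b →
                     levelPattern A B M q i ≡ M *ᶻ (a -ᶻ b) +ᶻ q *ᶻ (1ℤ -ᶻ a -ᶻ b)
levelPattern-value A B M q i χA≡a χB≡b = cong₂ (λ a b → M *ᶻ (a -ᶻ b) +ᶻ q *ᶻ (1ℤ -ᶻ a -ᶻ b)) χA≡a χB≡b

levelPattern-topLevel : ∀ {n} {A B : Subset n} {M q} → Empty (A ∩ B) → q <ᶻ M → - q <ᶻ M → 0ℤ <ᶻ M →
                        IsTopLevel (levelPattern A B M q) M (A , B)
levelPattern-topLevel {n} {A} {B} {M} {q} A∩B≡∅ q<M -q<M 0<M = topLevel-of-strict on-S off-S
  where
  d : Fin n → ℤ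
  d = levelPattern A B M q
  on-A : ∀ {i} → i ∈ A → d i ≡ M
  on-A {i} i∈A = trans (levelPattern-value A B M q i (χ-∈ i∈A) (χ-∉ (disjoint⇒∉ A∩B≡∅ i∈A))) (value-A M q)
    where
    value-A : ∀ M q → M *ᶻ (1ℤ -ᶻ 0ℤ) +ᶻ q *ᶻ (1ℤ -ᶻ 1ℤ -ᶻ 0ℤ) ≡ M
    value-A = solve-∀
  on-B : ∀ {i} → i ∈ B → d i ≡ - M
  on-B {i} i∈B =
    trans (levelPattern-value A B M q i (χ-∉ (λ i∈A → disjoint⇒∉ A∩B≡∅ i∈A i∈B)) (χ-∈ i∈B)) (value-B M q)
    where
    value-B : ∀ M q → M *ᶻ (0ℤ -ᶻ 1ℤ) +ᶻ q *ᶻ (1ℤ -ᶻ 0ℤ -ᶻ 1ℤ) ≡ - M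
    value-B = solve-∀
  off-AB : ∀ {i} → i ∉ A → i ∉ B → d i ≡ q
  off-AB {i} i∉A i∉B = trans (levelPattern-value A B M q i (χ-∉ i∉A) (χ-∉ i∉B)) (value-off M q)
    where
    value-off : ∀ M q → M *ᶻ (0ℤ -ᶻ 0ℤ) +ᶻ q *ᶻ (1ℤ -ᶻ 0ℤ -ᶻ 0ℤ) ≡ q
    value-off = solve-∀
  -M<M : - M <ᶻ M
  -M<M = ℤₚ.<-trans (ℤₚ.neg-mono-< 0<M) 0<M
  on-S : ∀ {x} → x ∈ₚ (A , B) → edgeValue d x ≡ M
  on-S {i , true}  i∈A = on-A i∈A
  on-S {i , false} i∈B = trans (cong -_ (on-B i∈B)) (ℤₚ.neg-involutive M)
  off-S : ∀ {x} → ¬ (x ∈ₚ (A , B)) → edgeValue d x <ᶻ M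
  off-S {i , true} i∉A with i ∈? B
  ... | yes i∈B = subst (_<ᶻ M) (sym (on-B i∈B)) -M<M
  ... | no i∉B  = subst (_<ᶻ M) (sym (off-AB i∉A i∉B)) q<M
  off-S {i , false} i∉B with i ∈? A
  ... | yes i∈A = subst (_<ᶻ M) (sym (cong -_ (on-A i∈A))) -M<M
  ... | no i∉A  = subst (_<ᶻ M) (sym (cong -_ (off-AB i∉A i∉B))) -q<M

∑-levelPattern : ∀ {n} (A B : Subset n) M q →
                 ∑ (levelPattern A B M q) ≡ M *ᶻ (+ ∣ A ∣ -ᶻ + ∣ B ∣) +ᶻ q *ᶻ (+ n -ᶻ + ∣ A ∣ -ᶻ + ∣ B ∣)
∑-levelPattern {n} A B M q = begin
  ∑ (levelPattern A B M q)
    ≡⟨ ∑-distrib-+ (λ i → M *ᶻ (χ A i -ᶻ χ B i)) (λ i → q *ᶻ (1ℤ -ᶻ χ A i -ᶻ χ B i)) ⟩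
  ∑ (λ i → M *ᶻ (χ A i -ᶻ χ B i)) +ᶻ ∑ (λ i → q *ᶻ (1ℤ -ᶻ χ A i -ᶻ χ B i))
    ≡⟨ cong₂ _+ᶻ_ (∑-*ˡ M (λ i → χ A i -ᶻ χ B i)) (∑-*ˡ q (λ i → 1ℤ -ᶻ χ A i -ᶻ χ B i)) ⟩
  M *ᶻ ∑ (λ i → χ A i -ᶻ χ B i) +ᶻ q *ᶻ ∑ (λ i → 1ℤ -ᶻ χ A i -ᶻ χ B i)
    ≡⟨ cong₂ (λ u v → M *ᶻ u +ᶻ q *ᶻ v) ∑-χA-χB ∑-1-χA-χB ⟩
  M *ᶻ (+ ∣ A ∣ -ᶻ + ∣ B ∣) +ᶻ q *ᶻ (+ n -ᶻ + ∣ A ∣ -ᶻ + ∣ B ∣) ∎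
  where
  open ≡-Reasoning
  ∑-χA-χB : ∑ (λ i → χ A i -ᶻ χ B i) ≡ + ∣ A ∣ -ᶻ + ∣ B ∣
  ∑-χA-χB = trans (∑-distrib-- (χ A) (χ B)) (cong₂ _-ᶻ_ (∑-χ A) (∑-χ B))
  ∑-1-χA-χB : ∑ (λ i → 1ℤ -ᶻ χ A i -ᶻ χ B i) ≡ + n -ᶻ + ∣ A ∣ -ᶻ + ∣ B ∣
  ∑-1-χA-χB = begin
    ∑ (λ i → 1ℤ -ᶻ χ A i -ᶻ χ B i)        ≡⟨ ∑-distrib-- (λ i → 1ℤ -ᶻ χ A i) (χ B) ⟩
    ∑ (λ i → 1ℤ -ᶻ χ A i) -ᶻ ∑ (χ B)      ≡⟨ cong (_-ᶻ ∑ (χ B)) (∑-distrib-- (λ _ → 1ℤ) (χ A)) ⟩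
    ∑ {n} (λ _ → 1ℤ) -ᶻ ∑ (χ A) -ᶻ ∑ (χ B) ≡⟨ cong₂ _-ᶻ_ (cong₂ _-ᶻ_ (∑-const-1 n) (∑-χ A)) (∑-χ B) ⟩
    + n -ᶻ + ∣ A ∣ -ᶻ + ∣ B ∣              ∎

x<x+y : ∀ x {y} → 0ℤ <ᶻ y → x <ᶻ x +ᶻ y
x<x+y x 0<y = subst (_<ᶻ x +ᶻ _) (ℤₚ.+-identityʳ x) (ℤₚ.+-monoʳ-< x 0<y)

0<k-a : ∀ {a k} → a < k → 0ℤ <ᶻ + k -ᶻ + a
0<k-a {a} {k} a<k = subst (0ℤ <ᶻ_) (sym (trans (ℤₚ.m-n≡m⊖n k a) (ℤₚ.⊖-≥ (ℕₚ.<⇒≤ a<k))))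
                          (+<+ (ℕₚ.m<n⇒0<n∸m a<k))

goodPair⇒topLevel : ∀ {k} {S : PtSet (2 * k)} → IsGoodPair k S →
                    Σ (Fin (2 * k) → ℤ) λ d → ∑ d ≡ 0ℤ × Σ ℤ λ M → IsTopLevel d M S
goodPair⇒topLevel {k} {A , B} (A∩B≡∅ , inj₁ (∣A∣≡k , ∣B∣≡k)) =
  levelPattern A B 1ℤ 0ℤ , ∑≡0 , 1ℤ , levelPattern-topLevel A∩B≡∅ (+<+ (s≤s z≤n)) (+<+ (s≤s z≤n)) (+<+ (s≤s z≤n))
  where
  ∑≡0 : ∑ (levelPattern A B 1ℤ 0ℤ) ≡ 0ℤ
  ∑≡0 = trans (∑-levelPattern A B 1ℤ 0ℤ)
    (trans (cong₂ (λ a b → 1ℤ *ᶻ (+ a -ᶻ + b) +ᶻ 0ℤ *ᶻ (+ (2 * k) -ᶻ + a -ᶻ + b)) ∣A∣≡k ∣B∣≡k)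
           (vanish (+ k) (+ (2 * k) -ᶻ + k -ᶻ + k)))
    where
    vanish : ∀ x y → 1ℤ *ᶻ (x -ᶻ x) +ᶻ 0ℤ *ᶻ y ≡ 0ℤ
    vanish = solve-∀
-- With a = ∣A∣ and b = ∣B∣, the values M = (k − a) + (k − b) and q = b − a make the sum
-- M (a − b) + q (2k − a − b) vanish, and k − a, k − b > 0 make M exceed both q and − q.
goodPair⇒topLevel {k} {A , B} (A∩B≡∅ , inj₂ (∣A∣<k , ∣B∣<k)) =
  levelPattern A B M q , ∑≡0 , M , levelPattern-topLevel A∩B≡∅ q<M -q<M 0<M
  where
  a b K M q : ℤ
  a = + ∣ A ∣
  b = + ∣ B ∣
  K = + k
  M = (K -ᶻ a) +ᶻ (K -ᶻ b)
  q = b -ᶻ a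
  ∑≡0 : ∑ (levelPattern A B M q) ≡ 0ℤ
  ∑≡0 = trans (∑-levelPattern A B M q)
    (trans (cong (λ n → M *ᶻ (a -ᶻ b) +ᶻ q *ᶻ (n -ᶻ a -ᶻ b)) (trans (cong +_ (2*k≡k+k k)) (ℤₚ.pos-+ k k)))
           (vanish K a b))
    where
    vanish : ∀ K a b → ((K -ᶻ a) +ᶻ (K -ᶻ b)) *ᶻ (a -ᶻ b) +ᶻ (b -ᶻ a) *ᶻ ((K +ᶻ K) -ᶻ a -ᶻ b) ≡ 0ℤ
    vanish = solve-∀
  q<M : q <ᶻ M
  q<M = subst (q <ᶻ_) (sym (rearrange K a b)) (x<x+y q (ℤₚ.+-mono-< (0<k-a ∣B∣<k) (0<k-a ∣B∣<k)))
    where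
    rearrange : ∀ K a b → (K -ᶻ a) +ᶻ (K -ᶻ b) ≡ (b -ᶻ a) +ᶻ ((K -ᶻ b) +ᶻ (K -ᶻ b))
    rearrange = solve-∀
  -q<M : - q <ᶻ M
  -q<M = subst (- q <ᶻ_) (sym (rearrange K a b)) (x<x+y (- q) (ℤₚ.+-mono-< (0<k-a ∣A∣<k) (0<k-a ∣A∣<k)))
    where
    rearrange : ∀ K a b → (K -ᶻ a) +ᶻ (K -ᶻ b) ≡ - (b -ᶻ a) +ᶻ ((K -ᶻ a) +ᶻ (K -ᶻ a))
    rearrange = solve-∀
  0<M : 0ℤ <ᶻ M
  0<M = ℤₚ.+-mono-< (0<k-a ∣A∣<k) (0<k-a ∣B∣<k)

face⇒full⊎goodPair : ∀ {k} {S : PtSet (2 * k)} → IsFace S → FullPt S ⊎ IsGoodPair k S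
face⇒full⊎goodPair {k} {A , B} (inj₁ S≡∅) =
  inj₂ (∉⇒disjoint (λ i∈A _ → S≡∅ (_ , true) i∈A) ,
        sizes-balanced-or-small k A B (large ∣A∣≡0 ∣B∣≡0) (large ∣B∣≡0 ∣A∣≡0))
  where
  ∣A∣≡0 : ∣ A ∣ ≡ 0
  ∣A∣≡0 = trans (cong ∣_∣ (Empty-unique λ (i , i∈A) → S≡∅ (i , true) i∈A)) (∣⊥∣≡0 (2 * k))
  ∣B∣≡0 : ∣ B ∣ ≡ 0
  ∣B∣≡0 = trans (cong ∣_∣ (Empty-unique λ (i , i∈B) → S≡∅ (i , false) i∈B)) (∣⊥∣≡0 (2 * k))
  large : ∀ {x y} → x ≡ 0 → y ≡ 0 → k ≤ x → x ≡ k × y ≡ k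
  large refl refl k≤0 = let k≡0 = ℕₚ.n≤0⇒n≡0 k≤0 in sym k≡0 , sym k≡0
face⇒full⊎goodPair {zero}  (inj₂ _) = inj₁ λ { (() , _) }
face⇒full⊎goodPair {suc k} (inj₂ exposed) =
  let d , ∑d≡0 , M , top = exposed⇒topLevel exposed in topLevel-classify d M ∑d≡0 top

goodPair⇒exposed : ∀ {k} {S : PtSet (2 * k)} → IsGoodPair k S → (∃ λ x → x ∈ₚ S) → IsExposed S
goodPair⇒exposed good S≢∅ = let d , ∑d≡0 , _ , top = goodPair⇒topLevel good in topLevel⇒exposed d ∑d≡0 top S≢∅

goodPair⇒face : ∀ {k} {S : PtSet (2 * k)} → IsGoodPair k S → IsFace S
goodPair⇒face {S = A , B} good with nonempty? A | nonempty? B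
... | yes (i , i∈A) | _             = inj₂ (goodPair⇒exposed good ((i , true) , i∈A))
... | no _          | yes (i , i∈B) = inj₂ (goodPair⇒exposed good ((i , false) , i∈B))
... | no A≡∅        | no B≡∅        = inj₁ λ { (i , true) i∈A → A≡∅ (i , i∈A) ; (i , false) i∈B → B≡∅ (i , i∈B) }

disjoint⇒¬full : ∀ {m} {A B : Subset (suc m)} → Empty (A ∩ B) → ¬ FullPt (A , B)
disjoint⇒¬full A∩B≡∅ full = disjoint⇒∉ A∩B≡∅ (full (zero , true)) (full (zero , false))

IsDisjointOfSizes : ∀ {n} → ℕ → ℕ → PtSet n → Set
IsDisjointOfSizes a b (A , B) = Empty (A ∩ B) × ∣ A ∣ ≡ a × ∣ B ∣ ≡ b

IsSmallPair : ∀ {n} → ℕ → ℕ → PtSet n → Set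
IsSmallPair k j (A , B) = Empty (A ∩ B) × ∣ A ∣ < k × ∣ B ∣ < k × ∣ A ∣ + ∣ B ∣ ≡ j

small-sum< : ∀ {k a b} → a < k → b < k → a + b < 2 * k ∸ 1
small-sum< {suc k} (s≤s a≤k) (s≤s b≤k) =
  ℕₚ.≤-<-trans (ℕₚ.+-mono-≤ a≤k b≤k) (ℕₚ.+-monoʳ-< k (s≤s (ℕₚ.≤-reflexive (sym (ℕₚ.+-identityʳ k)))))

DimSuc-of-balanced : ∀ {k} → 1 ≤ k → {S : PtSet (2 * k)} → IsDisjointOfSizes k k S → DimSuc S (2 * k ∸ 1)
DimSuc-of-balanced {suc k} _ {A , B} (A∩B≡∅ , ∣A∣≡k , ∣B∣≡k) =
  DimSuc-of-partition A∩B≡∅ (trans ∣A∣≡k (sym ∣B∣≡k)) (trans (cong₂ _+_ ∣A∣≡k ∣B∣≡k) (sym (2*k≡k+k (suc k))))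

DimSuc-of-unbalanced : ∀ {k} {A B : Subset (2 * k)} → Empty (A ∩ B) → ∣ A ∣ < k → ∣ B ∣ < k →
                       DimSuc (A , B) (∣ A ∣ + ∣ B ∣)
DimSuc-of-unbalanced {k} A∩B≡∅ ∣A∣<k ∣B∣<k =
  DimSuc-of-small A∩B≡∅ (ℕₚ.<-≤-trans (small-sum< ∣A∣<k ∣B∣<k) (ℕₚ.m∸n≤m (2 * k) 1))

facets⇔balanced : ∀ {k} → 1 ≤ k → (S : PtSet (2 * k)) →
                  (IsFace S × DimSuc S (2 * k ∸ 1)) ⇔ IsDisjointOfSizes k k S
facets⇔balanced {k@(suc _)} 1≤k (A , B) = mk⇔ to from
  where
  to : IsFace (A , B) × DimSuc (A , B) (2 * k ∸ 1) → IsDisjointOfSizes k k (A , B)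
  to (face , dim) with face⇒full⊎goodPair {k} face
  ... | inj₁ full = contradiction (DimSuc-of-full (ℕₚ.*-monoʳ-≤ 2 1≤k) full dim) (ℕₚ.<-irrefl refl)
  ... | inj₂ (A∩B≡∅ , inj₁ (∣A∣≡k , ∣B∣≡k)) = A∩B≡∅ , ∣A∣≡k , ∣B∣≡k
  ... | inj₂ (A∩B≡∅ , inj₂ (∣A∣<k , ∣B∣<k)) =
    contradiction (DimSuc-unique (DimSuc-of-unbalanced A∩B≡∅ ∣A∣<k ∣B∣<k) dim) (ℕₚ.<⇒≢ (small-sum< ∣A∣<k ∣B∣<k))
  from : IsDisjointOfSizes k k (A , B) → IsFace (A , B) × DimSuc (A , B) (2 * k ∸ 1)
  from balanced@(A∩B≡∅ , ∣A∣≡k , ∣B∣≡k) =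
    goodPair⇒face {k} (A∩B≡∅ , inj₁ (∣A∣≡k , ∣B∣≡k)) , DimSuc-of-balanced 1≤k balanced

lowerFaces⇔small : ∀ {k} → 1 ≤ k → ∀ {j} → j < 2 * k ∸ 1 → (S : PtSet (2 * k)) →
                   (IsFace S × DimSuc S j) ⇔ IsSmallPair k j S
lowerFaces⇔small {k@(suc _)} 1≤k {j} j<n-1 (A , B) = mk⇔ to from
  where
  to : IsFace (A , B) × DimSuc (A , B) j → IsSmallPair k j (A , B)
  to (face , dim) with face⇒full⊎goodPair {k} face
  ... | inj₁ full = contradiction (DimSuc-of-full (ℕₚ.*-monoʳ-≤ 2 1≤k) full dim) (ℕₚ.<⇒≱ (ℕₚ.m<n⇒m<1+n j<n-1))
  ... | inj₂ (A∩B≡∅ , inj₁ (∣A∣≡k , ∣B∣≡k)) =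
    contradiction (DimSuc-unique dim (DimSuc-of-balanced 1≤k (A∩B≡∅ , ∣A∣≡k , ∣B∣≡k))) (ℕₚ.<⇒≢ j<n-1)
  ... | inj₂ (A∩B≡∅ , inj₂ (∣A∣<k , ∣B∣<k)) =
    A∩B≡∅ , ∣A∣<k , ∣B∣<k , DimSuc-unique (DimSuc-of-unbalanced A∩B≡∅ ∣A∣<k ∣B∣<k) dim
  from : IsSmallPair k j (A , B) → IsFace (A , B) × DimSuc (A , B) j
  from (A∩B≡∅ , ∣A∣<k , ∣B∣<k , ∣A∣+∣B∣≡j) =
    goodPair⇒face {k} (A∩B≡∅ , inj₂ (∣A∣<k , ∣B∣<k)) ,
    subst (DimSuc (A , B)) ∣A∣+∣B∣≡j (DimSuc-of-unbalanced A∩B≡∅ ∣A∣<k ∣B∣<k)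

-- Enumerating disjoint pairs of subsets of given sizes

infixr 5 _◂_
_◂_ : ∀ {n} → Bool × Bool → PtSet n → PtSet (suc n)
(x , y) ◂ (A , B) = x ∷ A , y ∷ B

◂-injective : ∀ {n} h {S T : PtSet n} → h ◂ S ≡ h ◂ T → S ≡ T
◂-injective _ refl = refl

heads : ∀ {n} → PtSet (suc n) → Bool × Bool
heads (x ∷ _ , y ∷ _) = x , y

heads-∈-map-◂ : ∀ {n} h {S} {Ts : List (PtSet n)} → S ∈ₗ map (h ◂_) Ts → heads S ≡ h
heads-∈-map-◂ h S∈ with ∈-map⁻ (h ◂_) S∈
... | _ , _ , refl = refl

onPred : ∀ {X : Set} → (ℕ → List X) → ℕ → List X
onPred f zero    = []
onPred f (suc a) = f a

disjointPairs : ∀ n → ℕ → ℕ → List (PtSet n)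
disjointPairs zero    zero    zero    = ([] , []) ∷ []
disjointPairs zero    _       _       = []
disjointPairs (suc n) a b =
  map ((true , false) ◂_) (onPred (λ a′ → disjointPairs n a′ b) a) ++
  map ((false , true) ◂_) (onPred (disjointPairs n a) b) ++
  map ((false , false) ◂_) (disjointPairs n a b)

Empty-outside∷ : ∀ {n} {p : Subset n} → Empty p → Empty (outside ∷ p)
Empty-outside∷ p≡∅ (suc i , there i∈p) = p≡∅ (i , i∈p)

∈-disjointPairs⁻ : ∀ n a b {S : PtSet n} → S ∈ₗ disjointPairs n a b → IsDisjointOfSizes a b S
∈-disjointPairs⁻ zero zero zero (here refl) = (λ { (() , _) }) , refl , refl
∈-disjointPairs⁻ (suc n) a b S∈ with ∈-++⁻ (map ((true , false) ◂_) (onPred (λ a′ → disjointPairs n a′ b) a)) S∈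
∈-disjointPairs⁻ (suc n) (suc a) b S∈ | inj₁ S∈₁ with ∈-map⁻ ((true , false) ◂_) S∈₁
... | _ , T∈ , refl = let T⁺∩T⁻≡∅ , ∣T⁺∣≡a , ∣T⁻∣≡b = ∈-disjointPairs⁻ n a b T∈
                      in Empty-outside∷ T⁺∩T⁻≡∅ , cong suc ∣T⁺∣≡a , ∣T⁻∣≡b
∈-disjointPairs⁻ (suc n) a b S∈ | inj₂ S∈₂₃ with ∈-++⁻ (map ((false , true) ◂_) (onPred (disjointPairs n a) b)) S∈₂₃
∈-disjointPairs⁻ (suc n) a (suc b) S∈ | inj₂ _ | inj₁ S∈₂ with ∈-map⁻ ((false , true) ◂_) S∈₂
... | _ , T∈ , refl = let T⁺∩T⁻≡∅ , ∣T⁺∣≡a , ∣T⁻∣≡b = ∈-disjointPairs⁻ n a b T∈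
                      in Empty-outside∷ T⁺∩T⁻≡∅ , ∣T⁺∣≡a , cong suc ∣T⁻∣≡b
∈-disjointPairs⁻ (suc n) a b S∈ | inj₂ _ | inj₂ S∈₃ with ∈-map⁻ ((false , false) ◂_) S∈₃
... | _ , T∈ , refl = let T⁺∩T⁻≡∅ , ∣T⁺∣≡a , ∣T⁻∣≡b = ∈-disjointPairs⁻ n a b T∈
                      in Empty-outside∷ T⁺∩T⁻≡∅ , ∣T⁺∣≡a , ∣T⁻∣≡b

∈-disjointPairs⁺ : ∀ {n} {A B : Subset n} → Empty (A ∩ B) → (A , B) ∈ₗ disjointPairs n ∣ A ∣ ∣ B ∣
∈-disjointPairs⁺ {A = []}        {[]}        _      = here refl
∈-disjointPairs⁺ {A = true ∷ A}  {true ∷ B}  A∩B≡∅ = contradiction (zero , here) A∩B≡∅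
∈-disjointPairs⁺ {A = true ∷ A}  {false ∷ B} A∩B≡∅ =
  ∈-++⁺ˡ (∈-map⁺ ((true , false) ◂_) (∈-disjointPairs⁺ (drop-∷-Empty A∩B≡∅)))
∈-disjointPairs⁺ {suc n} {false ∷ A} {true ∷ B} A∩B≡∅ =
  ∈-++⁺ʳ (map ((true , false) ◂_) (onPred (λ a′ → disjointPairs n a′ (suc ∣ B ∣)) ∣ A ∣))
         (∈-++⁺ˡ (∈-map⁺ ((false , true) ◂_) (∈-disjointPairs⁺ (drop-∷-Empty A∩B≡∅))))
∈-disjointPairs⁺ {suc n} {false ∷ A} {false ∷ B} A∩B≡∅ =
  ∈-++⁺ʳ (map ((true , false) ◂_) (onPred (λ a′ → disjointPairs n a′ ∣ B ∣) ∣ A ∣))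
         (∈-++⁺ʳ (map ((false , true) ◂_) (onPred (disjointPairs n ∣ A ∣) ∣ B ∣))
                 (∈-map⁺ ((false , false) ◂_) (∈-disjointPairs⁺ (drop-∷-Empty A∩B≡∅))))

∈-disjointPairs : ∀ n a b (S : PtSet n) → (S ∈ₗ disjointPairs n a b) ⇔ IsDisjointOfSizes a b S
∈-disjointPairs n a b (A , B) = mk⇔ (∈-disjointPairs⁻ n a b) λ { (A∩B≡∅ , refl , refl) → ∈-disjointPairs⁺ A∩B≡∅ }

disjoint-by-heads : ∀ {n} {h h′} {Ts Us : List (PtSet n)} → h ≢ h′ → Disjoint (map (h ◂_) Ts) (map (h′ ◂_) Us)
disjoint-by-heads {h = h} {h′} h≢h′ (S∈ , S∈′) = h≢h′ (trans (sym (heads-∈-map-◂ h S∈)) (heads-∈-map-◂ h′ S∈′))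

onPred-unique : ∀ {X : Set} {f : ℕ → List X} → (∀ a → Unique (f a)) → ∀ a → Unique (onPred f a)
onPred-unique f-unique zero    = []
onPred-unique f-unique (suc a) = f-unique a

disjointPairs-unique : ∀ n a b → Unique (disjointPairs n a b)
disjointPairs-unique zero    zero    zero    = All.[] ∷ []
disjointPairs-unique zero    zero    (suc b) = []
disjointPairs-unique zero    (suc a) b       = []
disjointPairs-unique (suc n) a b =
  Unique.++⁺ (Unique.map⁺ (◂-injective _) (onPred-unique (λ a′ → disjointPairs-unique n a′ b) a))
    (Unique.++⁺ (Unique.map⁺ (◂-injective _) (onPred-unique (disjointPairs-unique n a) b))
                (Unique.map⁺ (◂-injective _) (disjointPairs-unique n a b))
                (disjoint-by-heads λ ()))
    λ (S∈₁ , S∈₂₃) → [ (λ S∈₂ → disjoint-by-heads (λ ()) (S∈₁ , S∈₂))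
                     , (λ S∈₃ → disjoint-by-heads (λ ()) (S∈₁ , S∈₃)) ]
                       (∈-++⁻ (map ((false , true) ◂_) (onPred (disjointPairs n a) b)) S∈₂₃)

trinomial : ℕ → ℕ → ℕ → ℕ
trinomial n a b = (n C a) * ((n ∸ a) C b)

trinomial-pascal : ∀ n a b →
  trinomial n a (suc b) + (trinomial n (suc a) b + trinomial n (suc a) (suc b)) ≡ trinomial (suc n) (suc a) (suc b)
trinomial-pascal n a b = begin
  (n C a) * ((n ∸ a) C suc b) + ((n C suc a) * ((n ∸ suc a) C b) + (n C suc a) * ((n ∸ suc a) C suc b))
    ≡⟨ cong (_+_ ((n C a) * ((n ∸ a) C suc b))) (trans (sym (ℕₚ.*-distribˡ-+ (n C suc a) _ _)) inner) ⟩
  (n C a) * ((n ∸ a) C suc b) + (n C suc a) * ((n ∸ a) C suc b)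
    ≡⟨ ℕₚ.*-distribʳ-+ ((n ∸ a) C suc b) (n C a) (n C suc a) ⟨
  (n C a + n C suc a) * ((n ∸ a) C suc b)
    ≡⟨ cong (_* ((n ∸ a) C suc b)) (nCk+nC[k+1]≡[n+1]C[k+1] n a) ⟩
  (suc n C suc a) * ((n ∸ a) C suc b)
    ∎
  where
  open ≡-Reasoning
  inner : (n C suc a) * ((n ∸ suc a) C b + (n ∸ suc a) C suc b) ≡ (n C suc a) * ((n ∸ a) C suc b)
  inner with suc a ℕ.≤? n
  ... | yes a<n = cong ((n C suc a) *_)
                       (trans (nCk+nC[k+1]≡[n+1]C[k+1] (n ∸ suc a) b) (cong (_C suc b) (sym (ℕₚ.+-∸-assoc 1 a<n))))
  ... | no a≮n  = let nCa+1≡0 = k>n⇒nCk≡0 (ℕₚ.≰⇒> a≮n) in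
                  trans (cong (_* ((n ∸ suc a) C b + (n ∸ suc a) C suc b)) nCa+1≡0)
                        (sym (cong (_* ((n ∸ a) C suc b)) nCa+1≡0))

length-blocks : ∀ {n} (Xs Ys Zs : List (PtSet n)) →
                length (map ((true , false) ◂_) Xs ++ map ((false , true) ◂_) Ys ++ map ((false , false) ◂_) Zs)
                ≡ length Xs + (length Ys + length Zs)
length-blocks Xs Ys Zs = begin
  length (map _ Xs ++ map _ Ys ++ map _ Zs)            ≡⟨ LP.length-++ (map _ Xs) ⟩
  length (map _ Xs) + length (map _ Ys ++ map _ Zs)    ≡⟨ cong (_+_ (length (map _ Xs))) (LP.length-++ (map _ Ys)) ⟩
  length (map _ Xs) + (length (map _ Ys) + length (map _ Zs))
    ≡⟨ cong₂ _+_ (LP.length-map _ Xs) (cong₂ _+_ (LP.length-map _ Ys) (LP.length-map _ Zs)) ⟩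
  length Xs + (length Ys + length Zs)                  ∎
  where open ≡-Reasoning

length-disjointPairs : ∀ n a b → length (disjointPairs n a b) ≡ trinomial n a b
length-disjointPairs zero zero zero = refl
length-disjointPairs zero zero (suc b) = refl
length-disjointPairs zero (suc a) b = refl
length-disjointPairs (suc n) a b =
  trans (length-blocks (onPred (λ a′ → disjointPairs n a′ b) a) (onPred (disjointPairs n a) b) (disjointPairs n a b))
        (step a b)
  where
  step : ∀ a b → length (onPred (λ a′ → disjointPairs n a′ b) a) +
                 (length (onPred (disjointPairs n a) b) + length (disjointPairs n a b)) ≡ trinomial (suc n) a b
  step zero    zero    = length-disjointPairs n 0 0
  step zero    (suc b) = begin
    length (disjointPairs n 0 b) + length (disjointPairs n 0 (suc b))
      ≡⟨ cong₂ _+_ (trans (length-disjointPairs n 0 b) (ℕₚ.*-identityˡ (n C b)))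
                   (trans (length-disjointPairs n 0 (suc b)) (ℕₚ.*-identityˡ (n C suc b))) ⟩
    n C b + n C suc b ≡⟨ nCk+nC[k+1]≡[n+1]C[k+1] n b ⟩
    suc n C suc b     ≡⟨ ℕₚ.*-identityˡ (suc n C suc b) ⟨
    trinomial (suc n) 0 (suc b) ∎
    where open ≡-Reasoning
  step (suc a) zero    = begin
    length (disjointPairs n a 0) + length (disjointPairs n (suc a) 0)
      ≡⟨ cong₂ _+_ (trans (length-disjointPairs n a 0) (ℕₚ.*-identityʳ (n C a)))
                   (trans (length-disjointPairs n (suc a) 0) (ℕₚ.*-identityʳ (n C suc a))) ⟩
    n C a + n C suc a ≡⟨ nCk+nC[k+1]≡[n+1]C[k+1] n a ⟩
    suc n C suc a     ≡⟨ ℕₚ.*-identityʳ (suc n C suc a) ⟨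
    trinomial (suc n) (suc a) 0 ∎
    where open ≡-Reasoning
  step (suc a) (suc b) =
    trans (cong₂ _+_ (length-disjointPairs n a (suc b))
                     (cong₂ _+_ (length-disjointPairs n (suc a) b) (length-disjointPairs n (suc a) (suc b))))
          (trinomial-pascal n a b)

length-concatMap : ∀ {X Y : Set} (f : X → List Y) xs → length (concatMap f xs) ≡ sum (map (length ∘ f) xs)
length-concatMap f []       = refl
length-concatMap f (x ∷ xs) = trans (LP.length-++ (f x)) (cong (_+_ (length (f x))) (length-concatMap f xs))

module _ {X : Set} where

  length-if : ∀ b (xs : List X) → length (if b then xs else []) ≡ (if b then length xs else 0)
  length-if true  xs = refl
  length-if false xs = refl

  ∈-if⁻ : ∀ b {xs : List X} {x} → x ∈ₗ (if b then xs else []) → T b × x ∈ₗ xs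
  ∈-if⁻ true x∈ = _ , x∈

  ∈-if⁺ : ∀ {b} {xs : List X} {x} → T b → x ∈ₗ xs → x ∈ₗ (if b then xs else [])
  ∈-if⁺ {true} _ x∈ = x∈

  if-unique : ∀ b {xs : List X} → Unique xs → Unique (if b then xs else [])
  if-unique true  xs! = xs!
  if-unique false _   = []

pairsOfSmallSizes : ∀ n → ℕ → ℕ → ℕ → List (PtSet n)
pairsOfSmallSizes n k j a = if does (a <? k) ∧ does ((j ∸ a) <? k) then disjointPairs n a (j ∸ a) else []

smallPairs : ∀ n → ℕ → ℕ → List (PtSet n)
smallPairs n k j = concatMap (pairsOfSmallSizes n k j) (upTo (suc j))

length-smallPairs : ∀ n k j → length (smallPairs n k j) ≡
  sum (map (λ a → if does (a <? k) ∧ does ((j ∸ a) <? k) then trinomial n a (j ∸ a) else 0) (upTo (suc j)))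
length-smallPairs n k j = trans (length-concatMap (pairsOfSmallSizes n k j) (upTo (suc j)))
  (cong sum (LP.map-cong (λ a → trans (length-if _ (disjointPairs n a (j ∸ a)))
                                      (cong (if does (a <? k) ∧ does ((j ∸ a) <? k) then_else 0)
                                            (length-disjointPairs n a (j ∸ a))))
                         (upTo (suc j))))

∈-pairsOfSmallSizes⁻ : ∀ n k j a {S : PtSet n} → S ∈ₗ pairsOfSmallSizes n k j a →
                       a < k × j ∸ a < k × IsDisjointOfSizes a (j ∸ a) S
∈-pairsOfSmallSizes⁻ n k j a S∈ =
  let selected , S∈′ = ∈-if⁻ (does (a <? k) ∧ does ((j ∸ a) <? k)) S∈
      a<k? , b<k? = Equivalence.to (T-∧ {does (a <? k)}) selected
  in ℕₚ.<ᵇ⇒< a k a<k? , ℕₚ.<ᵇ⇒< (j ∸ a) k b<k? , ∈-disjointPairs⁻ n a (j ∸ a) S∈′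

∈-smallPairs : ∀ n k j (S : PtSet n) → (S ∈ₗ smallPairs n k j) ⇔ IsSmallPair k j S
∈-smallPairs n k j (A , B) = mk⇔ to from
  where
  to : (A , B) ∈ₗ smallPairs n k j → IsSmallPair k j (A , B)
  to S∈ with find (∈-concatMap⁻ (pairsOfSmallSizes n k j) S∈)
  ... | a , a∈ , S∈ₐ with ∈-pairsOfSmallSizes⁻ n k j a S∈ₐ
  ... | a<k , j-a<k , A∩B≡∅ , refl , ∣B∣≡j-a =
    A∩B≡∅ , a<k , subst (_< k) (sym ∣B∣≡j-a) j-a<k ,
    trans (cong (_+_ ∣ A ∣) ∣B∣≡j-a) (ℕₚ.m+[n∸m]≡n (ℕ.s≤s⁻¹ (∈-upTo⁻ a∈)))
  from : IsSmallPair k j (A , B) → (A , B) ∈ₗ smallPairs n k j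
  from (A∩B≡∅ , ∣A∣<k , ∣B∣<k , ∣A∣+∣B∣≡j) =
    ∈-concatMap⁺ (pairsOfSmallSizes n k j)
      (lose (∈-upTo⁺ (s≤s (subst (∣ A ∣ ≤_) ∣A∣+∣B∣≡j (ℕₚ.m≤m+n ∣ A ∣ ∣ B ∣))))
            (∈-if⁺ (Equivalence.from (T-∧ {does (∣ A ∣ <? k)})
                     (ℕₚ.<⇒<ᵇ ∣A∣<k , ℕₚ.<⇒<ᵇ (subst (_< k) ∣B∣≡j-∣A∣ ∣B∣<k)))
                   (subst (λ b → (A , B) ∈ₗ disjointPairs n ∣ A ∣ b) ∣B∣≡j-∣A∣ (∈-disjointPairs⁺ A∩B≡∅))))
    where
    ∣B∣≡j-∣A∣ : ∣ B ∣ ≡ j ∸ ∣ A ∣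
    ∣B∣≡j-∣A∣ = trans (sym (ℕₚ.m+n∸m≡n ∣ A ∣ ∣ B ∣)) (cong (_∸ ∣ A ∣) ∣A∣+∣B∣≡j)

smallPairs-unique : ∀ n k j → Unique (smallPairs n k j)
smallPairs-unique n k j =
  Unique.concat⁺ (AllP.map⁺ (All.universal (λ a → if-unique _ (disjointPairs-unique n a (j ∸ a))) _))
                 (AllPairsP.map⁺ (AllPairs.map different-sizes (Unique.upTo⁺ (suc j))))
  where
  size : ∀ a {S} → S ∈ₗ pairsOfSmallSizes n k j a → ∣ proj₁ S ∣ ≡ a
  size a S∈ = proj₁ (proj₂ (proj₂ (proj₂ (∈-pairsOfSmallSizes⁻ n k j a S∈))))
  different-sizes : ∀ {a a′} → a ≢ a′ → Disjoint (pairsOfSmallSizes n k j a) (pairsOfSmallSizes n k j a′)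
  different-sizes {a} {a′} a≢a′ (S∈ , S∈′) = a≢a′ (trans (sym (size a S∈)) (size a′ S∈′))

length-balancedPairs : ∀ k → length (disjointPairs (2 * k) k k) ≡ (2 * k) C k
length-balancedPairs k = begin
  length (disjointPairs (2 * k) k k) ≡⟨ length-disjointPairs (2 * k) k k ⟩
  ((2 * k) C k) * ((2 * k ∸ k) C k)  ≡⟨ cong (λ m → ((2 * k) C k) * (m C k))
                                               (trans (cong (_∸ k) (2*k≡k+k k)) (ℕₚ.m+n∸m≡n k k)) ⟩
  ((2 * k) C k) * (k C k)            ≡⟨ cong (((2 * k) C k) *_) (nCn≡1 k) ⟩
  ((2 * k) C k) * 1                  ≡⟨ ℕₚ.*-identityʳ _ ⟩
  (2 * k) C k                        ∎
  where open ≡-Reasoning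

facets-HasCard : ∀ {k} → 1 ≤ k → HasCard {2 * k} (λ S → IsFace S × DimSuc S (2 * k ∸ 1)) ((2 * k) C k)
facets-HasCard {k} 1≤k =
  disjointPairs (2 * k) k k , disjointPairs-unique (2 * k) k k , length-balancedPairs k ,
  λ S → ⇔.trans (∈-disjointPairs (2 * k) k k S) (⇔.sym (facets⇔balanced 1≤k S))

lowerFaces-HasCard : ∀ {k} → 1 ≤ k → ∀ j → j < 2 * k ∸ 1 →
                     HasCard {2 * k} (λ S → IsFace S × DimSuc S j) (faceSum k j)
lowerFaces-HasCard {k} 1≤k j j<n-1 =
  smallPairs (2 * k) k j , smallPairs-unique (2 * k) k j , length-smallPairs (2 * k) k j ,
  λ S → ⇔.trans (∈-smallPairs (2 * k) k j S) (⇔.sym (lowerFaces⇔small 1≤k j<n-1 S))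

proposition4p3 : (k : ℕ) → 2 ≤ k →
    (Σ (Σ (PtSet (2 * k)) IsProperFace → Σ (Subset (2 * k) × Subset (2 * k)) (IsGoodPair k)) λ f →
     Σ (Σ (Subset (2 * k) × Subset (2 * k)) (IsGoodPair k) → Σ (PtSet (2 * k)) IsProperFace) λ g →
       (∀ F → proj₁ (g (f F)) ≡ proj₁ F)
       × (∀ Q → proj₁ (f (g Q)) ≡ proj₁ Q)
       × (∀ F F′ → (proj₁ F ⊆ₚ proj₁ F′) ⇔ (proj₁ (f F) ≤ₚ proj₁ (f F′))))
    × HasCard {2 * k} (λ S → IsFace S × DimSuc S (2 * k ∸ 1)) ((2 * k) C k)
    × (∀ j → j < 2 * k ∸ 1 → HasCard {2 * k} (λ S → IsFace S × DimSuc S j) (faceSum k j))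
-- Both maps keep the underlying pair of subsets, on which ⊆ₚ and ≤ₚ are the same relation.
proposition4p3 k@(suc _) 2≤k = (toGoodPair , toProperFace , (λ _ → refl) , (λ _ → refl) , (λ _ _ → mk⇔ id id)) ,
                               facets-HasCard 1≤k , lowerFaces-HasCard 1≤k
  where
  1≤k : 1 ≤ k
  1≤k = ℕₚ.<⇒≤ 2≤k
  toGoodPair : Σ (PtSet (2 * k)) IsProperFace → Σ (Subset (2 * k) × Subset (2 * k)) (IsGoodPair k)
  toGoodPair (S , face , ¬full) = S , [ (λ full → contradiction full ¬full) , id ] (face⇒full⊎goodPair {k} face)
  toProperFace : Σ (Subset (2 * k) × Subset (2 * k)) (IsGoodPair k) → Σ (PtSet (2 * k)) IsProperFace
  toProperFace (S , good) = S , goodPair⇒face {k} good , disjoint⇒¬full (proj₁ good)
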